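{- Let $G'$ and $G''$ be simple connected graphs on $[n]$ whose Laplacian simplices $\mathcal{P}_{G'}$ and $\mathcal{P}_{G''}$ are reflexive. Let $B$ be the bridge graph on $[2n]$ obtained by taking $G'$ on vertices $1,\dots,n$, a copy of $G''$ on vertices $n+1,\dots,2n$ (vertex $j$ of $G''$ becoming $n+j$), and adding the edge $\{n,2n\}$. Let $L$ be the Laplacian of $B$ and $L(2n)$ be $L$ with its $2n$-th column deleted, so $\mathcal{P}_B=\mathrm{conv}(\text{rows of }L(2n))$. Then the set of lattice points in the fundamental parallelepiped of $\mathcal{P}_B$ equals \[ \left\{(\lambda',\lambda'')\cdot[L(2n)\mid\mathbb{1}],\ \left((\lambda',\lambda'')+\tfrac{1}{2n}\mathbb{1}\right)\cdot[L(2n)\mid\mathbb{1}]\;\middle|\;\lambda'\in\Lambda(\mathcal{P}_{G'}),\ \lambda''\in\Lambda(\mathcal{P}_{G''}),\ \lambda'_n=\lambda''_n\right\}. \]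
   Context: The Laplacian matrix $L$ of a simple graph on $[m]$ has $L_{ii}=\deg(i)$, $L_{ij}=-1$ if $\{i,j\}$ is an edge and $0$ otherwise; the Laplacian simplex $\mathcal{P}_G$ is the convex hull in $\mathbb{R}^{m-1}$ of the rows $\mathbf{v}_1,\dots,\mathbf{v}_m$ (in order) of $L$ with its $m$-th column deleted. A lattice polytope is reflexive if it contains the origin in its interior and its dual is a lattice polytope. For a lattice simplex with ordered vertices $\mathbf{v}_1,\dots,\mathbf{v}_{d+1}$, the fundamental parallelepiped is $\{\sum_i\lambda_i(\mathbf{v}_i,1)\mid0\le\lambda_i<1\}$ and $\Lambda(\mathcal{P})$ is the set of $\lambda\in[0,1)^{d+1}$ with $\sum_i\lambda_i(\mathbf{v}_i,1)\in\mathbb{Z}^{d+1}$. $[M\mid\mathbb{1}]$ is $M$ with a column of ones appended.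
   Formalization: Points and coefficients of the Laplacian simplices, their duals, the fundamental parallelepiped and Λ are taken over ℚ rather than ℝ, as is the origin-in-interior condition of reflexivity. -}

module Defs where

open import Data.Bool using (Bool; true; false; if_then_else_)
open import Data.Nat as ℕ using (ℕ; zero; suc)
open import Data.Fin using (Fin; zero; suc; toℕ; inject₁; fromℕ; splitAt)
open import Data.Sum using (_⊎_; inj₁; inj₂)
open import Data.Product using (Σ; ∃; _×_; _,_)
open import Data.Integer as ℤ using (ℤ; +_)
open import Data.Rational using (ℚ; _+_; _*_; -_; _≤_; _<_; 0ℚ; 1ℚ; _/_)
open import Relation.Binary.PropositionalEquality using (_≡_)
open import Function.Bundles using (_⇔_)

∑ : ∀ {m} → (Fin m → ℚ) → ℚ
∑ {zero}  f = 0ℚ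
∑ {suc m} f = f zero + ∑ (λ i → f (suc i))

ι : ℤ → ℚ
ι z = z / 1

IsInt : ℚ → Set
IsInt q = ∃ λ (z : ℤ) → q ≡ ι z

IsSimple : ∀ {m} → (Fin m → Fin m → Bool) → Set
IsSimple adj = (∀ i j → adj i j ≡ adj j i) × (∀ i → adj i i ≡ false)

data Walk {m} (adj : Fin m → Fin m → Bool) : Fin m → Fin m → Set where
  here : ∀ {i} → Walk adj i i
  step : ∀ {i j l} → adj i j ≡ true → Walk adj j l → Walk adj i l

IsConnected : ∀ {m} → (Fin m → Fin m → Bool) → Set
IsConnected adj = ∀ i j → Walk adj i j

b2ℕ : Bool → ℕ
b2ℕ true  = 1
b2ℕ false = 0

countT : ∀ {m} → (Fin m → Bool) → ℕ
countT {zero}  f = 0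
countT {suc m} f = b2ℕ (f zero) ℕ.+ countT (λ j → f (suc j))

deg : ∀ {m} → (Fin m → Fin m → Bool) → Fin m → ℕ
deg adj i = countT (adj i)

eqFin : ∀ {m} → Fin m → Fin m → Bool
eqFin i j = toℕ i ℕ.≡ᵇ toℕ j

Lap : ∀ {m} → (Fin m → Fin m → Bool) → Fin m → Fin m → ℚ
Lap adj i j =
  if eqFin i j then ι (+ deg adj i)
  else (if adj i j then - 1ℚ else 0ℚ)

-- Laplacian simplex of a graph on Fin (suc d): vertices are the rows of
-- L with the last column deleted, points of ℚ^d.

vert : ∀ {d} → (Fin (suc d) → Fin (suc d) → Bool) → Fin (suc d) → Fin d → ℚ
vert adj i j = Lap adj i (inject₁ j)

-- [L(m) | 𝟙] : row i is (v_i , 1).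
augL : ∀ {d} → (Fin (suc d) → Fin (suc d) → Bool) → Fin (suc d) → Fin (suc d) → ℚ
augL {d} adj i j = if toℕ j ℕ.≡ᵇ d then 1ℚ else Lap adj i j

_·_ : ∀ {m k} → (Fin m → ℚ) → (Fin m → Fin k → ℚ) → Fin k → ℚ
(lam · M) j = ∑ (λ i → lam i * M i j)

InConv : ∀ {r d} → (Fin r → Fin d → ℚ) → (Fin d → ℚ) → Set
InConv {r} pts x = Σ (Fin r → ℚ) λ μ →
  (∀ i → 0ℚ ≤ μ i) × (∑ μ ≡ 1ℚ) × (∀ j → x j ≡ (μ · pts) j)

OriginInInterior : ∀ {d} → ((Fin d → ℚ) → Set) → Set
OriginInInterior {d} P = Σ ℚ λ ε → (0ℚ < ε) ×
  (∀ (x : Fin d → ℚ) → (∀ j → (- ε < x j) × (x j < ε)) → P x)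

Dual : ∀ {d} → ((Fin d → ℚ) → Set) → (Fin d → ℚ) → Set
Dual P y = ∀ x → P x → - 1ℚ ≤ ∑ (λ j → x j * y j)

IsLatticePolytope : ∀ {d} → ((Fin d → ℚ) → Set) → Set
IsLatticePolytope {d} S = Σ ℕ λ r → Σ (Fin r → Fin d → ℤ) λ pts →
  ∀ y → S y ⇔ InConv (λ i j → ι (pts i j)) y

IsReflexive : ∀ {d} → ((Fin d → ℚ) → Set) → Set
IsReflexive P = IsLatticePolytope P × OriginInInterior P × IsLatticePolytope (Dual P)

LaplacianSimplex : ∀ {d} → (Fin (suc d) → Fin (suc d) → Bool) → (Fin d → ℚ) → Set
LaplacianSimplex adj = InConv (vert adj)

Λ : ∀ {d} → (Fin (suc d) → Fin (suc d) → Bool) → (Fin (suc d) → ℚ) → Set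
Λ adj lam = (∀ i → (0ℚ ≤ lam i) × (lam i < 1ℚ)) × (∀ j → IsInt ((lam · augL adj) j))

FPPLatticePoint : ∀ {d} → (Fin (suc d) → Fin (suc d) → Bool) → (Fin (suc d) → ℚ) → Set
FPPLatticePoint {d} adj z = (∀ j → IsInt (z j)) ×
  Σ (Fin (suc d) → ℚ) λ lam → (∀ i → (0ℚ ≤ lam i) × (lam i < 1ℚ)) × (∀ j → z j ≡ (lam · augL adj) j)

-- Bridge graph on Fin (n + n), n = suc k: G' on the first n vertices,
-- G'' on the last n (vertex j ↦ n + j), plus the edge {n, 2n}
-- (i.e. the last vertex of each block).

isLast : ∀ {k} → Fin (suc k) → Bool
isLast {k} i = toℕ i ℕ.≡ᵇ k

bridge : ∀ {k} → (Fin (suc k) → Fin (suc k) → Bool) → (Fin (suc k) → Fin (suc k) → Bool)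
       → Fin (suc k ℕ.+ suc k) → Fin (suc k ℕ.+ suc k) → Bool
bridge {k} g₁ g₂ a b with splitAt (suc k) a | splitAt (suc k) b
... | inj₁ i | inj₁ j = g₁ i j
... | inj₂ i | inj₂ j = g₂ i j
... | inj₁ i | inj₂ j = if isLast i then isLast j else false
... | inj₂ i | inj₁ j = if isLast i then isLast j else false

-- Write a point of the fundamental parallelepiped of P_B as λ·[L(2n) | 𝟙] with λ = (λ′, λ″) ∈ [0,1)^2n.
-- Since the two blocks of the bridge Laplacian only interact through the edge {n, 2n}, the point is
-- integral iff λ′ and λ″ have integral columns against L(G′) and L(G″), λ′ₙ − λ″ₙ ∈ ℤ (hence
-- λ′ₙ = λ″ₙ) and ∑λ′ + ∑λ″ ∈ ℤ.
-- Reflexivity enters through integral facet normals: for every vertex i of P_G there is p ∈ ℤ^(n−1)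
-- with ⟨v_j, p⟩ = −1 for all j ≠ i. It comes from the rational solution of L x = n δᵢ − 𝟙 (G is
-- connected), which lies in the dual polytope; any lattice vertex of the dual carrying positive weight
-- in it is tight at every j ≠ i. Pairing μ·L(n) with p shows n μᵢ − ∑μ ∈ ℤ whenever μ has integral
-- columns. At the bridge vertex this gives ∑λ″ − ∑λ′ ∈ ℤ, so 2∑λ′ ∈ ℤ. If ∑λ′ ∈ ℤ then λ′, λ″ ∈ Λ;
-- otherwise every n λ′ᵢ, n λ″ᵢ lies in ½ + ℤ, so subtracting 1/(2n) keeps them in [0,1) and lands in Λ.

module Submission where

open import Defs

-- The development opens ℚ's _+_; the statement at the end needs ℕ's, so it lives outside this module.
module _ where

  open import Algebra.Bundles using (CommutativeRing)
  open import Data.Bool using (Bool; true; false; if_then_else_)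
  open import Data.Nat as ℕ using (ℕ; zero; suc)
  import Data.Nat.Properties as ℕ
  open import Data.Fin using (Fin; zero; suc; toℕ; inject₁; fromℕ; _↑ˡ_; _↑ʳ_; splitAt; join)
  import Data.Fin.Properties as Fin
  import Data.Fin.Relation.Unary.Top as Top
  open import Data.Integer as ℤ using (ℤ)
  import Data.Integer.Properties as ℤ
  import Data.Integer.DivMod as ℤ
  import Data.Integer.Tactic.RingSolver as ℤ
  import Data.Rational.Unnormalised.Properties as ℚᵘ
  import Data.Rational.Unnormalised as ℚᵘ
  open import Data.Rational
  open import Data.Rational.Properties
  open import Data.Nat.Coprimality using (1-coprimeTo) renaming (sym to coprime-sym)
  open import Data.Product using (Σ; ∃; _×_; _,_; proj₁; proj₂)
  open import Data.Sum using (_⊎_; inj₁; inj₂; [_,_])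
  open import Data.Vec.Functional using (_++_)
  import Data.Vec.Functional.Properties as Vec
  open import Data.Empty using (⊥-elim)
  open import Function using (_∘_; _⇔_; mk⇔; Equivalence)
  open import Data.Bool.Properties using (T-≡)
  open import Relation.Nullary using (yes; no)
  open import Relation.Nullary.Decidable using (dec⇒maybe; toWitness)
  open import Relation.Binary.PropositionalEquality
  open import Tactic.RingSolver using (solve-∀)
  open import Tactic.RingSolver.Core.AlmostCommutativeRing using (AlmostCommutativeRing; fromCommutativeRing)
  import Algebra.Properties.Semiring.Sum as SemiringSum
  open import Algebra.Properties.AbelianGroup +-0-abelianGroup using (xyx⁻¹≈y)

  ℚ-ring : AlmostCommutativeRing _ _
  ℚ-ring = fromCommutativeRing +-*-commutativeRing (λ x → dec⇒maybe (0ℚ ≟ x))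

  ι-mkℚ : ∀ z → ι z ≡ mkℚ z 0 (coprime-sym (1-coprimeTo _))
  ι-mkℚ z = ↥p/↧p≡p (mkℚ z 0 (coprime-sym (1-coprimeTo _)))

  toℚᵘ-ι : ∀ z → toℚᵘ (ι z) ≡ ℚᵘ.mkℚᵘ z 0
  toℚᵘ-ι z = cong toℚᵘ (ι-mkℚ z)

  ι-+ : ∀ a b → ι (a ℤ.+ b) ≡ ι a + ι b
  ι-+ a b = toℚᵘ-injective (begin
    toℚᵘ (ι (a ℤ.+ b))                    ≈⟨ ℚᵘ.≃-reflexive (toℚᵘ-ι (a ℤ.+ b)) ⟩
    ℚᵘ.mkℚᵘ (a ℤ.+ b) 0                   ≈⟨ ℚᵘ.*≡* (ℤ-identity a b) ⟩
    ℚᵘ.mkℚᵘ a 0 ℚᵘ.+ ℚᵘ.mkℚᵘ b 0          ≈⟨ ℚᵘ.≃-reflexive (cong₂ ℚᵘ._+_ (toℚᵘ-ι a) (toℚᵘ-ι b)) ⟨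
    toℚᵘ (ι a) ℚᵘ.+ toℚᵘ (ι b)            ≈⟨ toℚᵘ-homo-+ (ι a) (ι b) ⟨
    toℚᵘ (ι a + ι b)                      ∎)
    where
    open ℚᵘ.≃-Reasoning
    ℤ-identity : ∀ a b → (a ℤ.+ b) ℤ.* (ℤ.+ 1 ℤ.* ℤ.+ 1) ≡ (a ℤ.* ℤ.+ 1 ℤ.+ b ℤ.* ℤ.+ 1) ℤ.* ℤ.+ 1
    ℤ-identity = ℤ.solve-∀

  ι-* : ∀ a b → ι (a ℤ.* b) ≡ ι a * ι b
  ι-* a b = toℚᵘ-injective (begin
    toℚᵘ (ι (a ℤ.* b))                    ≈⟨ ℚᵘ.≃-reflexive (toℚᵘ-ι (a ℤ.* b)) ⟩
    ℚᵘ.mkℚᵘ (a ℤ.* b) 0                   ≈⟨ ℚᵘ.*≡* (ℤ-identity a b) ⟩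
    ℚᵘ.mkℚᵘ a 0 ℚᵘ.* ℚᵘ.mkℚᵘ b 0          ≈⟨ ℚᵘ.≃-reflexive (cong₂ ℚᵘ._*_ (toℚᵘ-ι a) (toℚᵘ-ι b)) ⟨
    toℚᵘ (ι a) ℚᵘ.* toℚᵘ (ι b)            ≈⟨ toℚᵘ-homo-* (ι a) (ι b) ⟨
    toℚᵘ (ι a * ι b)                      ∎)
    where
    open ℚᵘ.≃-Reasoning
    ℤ-identity : ∀ a b → (a ℤ.* b) ℤ.* (ℤ.+ 1 ℤ.* ℤ.+ 1) ≡ (a ℤ.* b) ℤ.* ℤ.+ 1
    ℤ-identity = ℤ.solve-∀

  ι-neg : ∀ a → ι (ℤ.- a) ≡ - ι a
  ι-neg a = toℚᵘ-injective (begin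
    toℚᵘ (ι (ℤ.- a))      ≈⟨ ℚᵘ.≃-reflexive (toℚᵘ-ι (ℤ.- a)) ⟩
    ℚᵘ.mkℚᵘ (ℤ.- a) 0     ≈⟨ ℚᵘ.≃-reflexive (cong ℚᵘ.-_ (toℚᵘ-ι a)) ⟨
    ℚᵘ.- toℚᵘ (ι a)       ≈⟨ toℚᵘ-homo‿- (ι a) ⟨
    toℚᵘ (- ι a)          ∎)
    where open ℚᵘ.≃-Reasoning

  ι-cancel-< : ∀ a b → ι a < ι b → a ℤ.< b
  ι-cancel-< a b p rewrite ι-mkℚ a | ι-mkℚ b with p
  ... | *<* q = subst₂ ℤ._<_ (ℤ.*-identityʳ a) (ℤ.*-identityʳ b) q

  ι-mono-≤ : ∀ a b → a ℤ.≤ b → ι a ≤ ι b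
  ι-mono-≤ a b p rewrite ι-mkℚ a | ι-mkℚ b =
    *≤* (subst₂ ℤ._≤_ (sym (ℤ.*-identityʳ a)) (sym (ℤ.*-identityʳ b)) p)

  0<ι+ : ∀ n → 0ℚ < ι (ℤ.+ suc n)
  0<ι+ n = subst (0ℚ <_) (sym (ι-mkℚ (ℤ.+ suc n))) (*<* (ℤ.+<+ (ℕ.s≤s ℕ.z≤n)))

  ι*inverse : ∀ m → ι (ℤ.+ suc m) * (ℤ.+ 1 / suc m) ≡ 1ℚ
  ι*inverse m = trans (cong₂ _*_ (ι-mkℚ (ℤ.+ suc m)) (↥p/↧p≡p (mkℚ (ℤ.+ 1) m (1-coprimeTo (suc m)))))
                      (*-inverseʳ (mkℚ (ℤ.+ suc m) 0 (coprime-sym (1-coprimeTo (suc m)))))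

  module S = SemiringSum (CommutativeRing.semiring +-*-commutativeRing)

  ∑≡sum : ∀ {m} (f : Fin m → ℚ) → ∑ f ≡ S.sum f
  ∑≡sum {zero}  f = refl
  ∑≡sum {suc m} f = cong (λ t → f zero + t) (∑≡sum (f ∘ suc))

  ∑-cong : ∀ {m} {f g : Fin m → ℚ} → (∀ i → f i ≡ g i) → ∑ f ≡ ∑ g
  ∑-cong {zero}  e = refl
  ∑-cong {suc m} e = cong₂ _+_ (e zero) (∑-cong (e ∘ suc))

  ∑-zero : ∀ m → ∑ {m} (λ _ → 0ℚ) ≡ 0ℚ
  ∑-zero m = trans (∑≡sum {m} (λ _ → 0ℚ)) (S.sum-replicate-zero m)

  ∑-distrib-+ : ∀ {m} (f g : Fin m → ℚ) → ∑ (λ i → f i + g i) ≡ ∑ f + ∑ g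
  ∑-distrib-+ f g = begin
    ∑ (λ i → f i + g i)  ≡⟨ ∑≡sum (λ i → f i + g i) ⟩
    S.sum (λ i → f i + g i) ≡⟨ S.∑-distrib-+ f g ⟩
    S.sum f + S.sum g    ≡⟨ cong₂ _+_ (∑≡sum f) (∑≡sum g) ⟨
    ∑ f + ∑ g            ∎
    where open ≡-Reasoning

  *-distribˡ-∑ : ∀ {m} (c : ℚ) (f : Fin m → ℚ) → c * ∑ f ≡ ∑ (λ i → c * f i)
  *-distribˡ-∑ c f = begin
    c * ∑ f                ≡⟨ cong (c *_) (∑≡sum f) ⟩
    c * S.sum f            ≡⟨ S.*-distribˡ-sum c f ⟩
    S.sum (λ i → c * f i)  ≡⟨ ∑≡sum (λ i → c * f i) ⟨
    ∑ (λ i → c * f i)      ∎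
    where open ≡-Reasoning

  *-distribʳ-∑ : ∀ {m} (c : ℚ) (f : Fin m → ℚ) → ∑ f * c ≡ ∑ (λ i → f i * c)
  *-distribʳ-∑ c f = begin
    ∑ f * c                ≡⟨ cong (_* c) (∑≡sum f) ⟩
    S.sum f * c            ≡⟨ S.*-distribʳ-sum c f ⟩
    S.sum (λ i → f i * c)  ≡⟨ ∑≡sum (λ i → f i * c) ⟨
    ∑ (λ i → f i * c)      ∎
    where open ≡-Reasoning

  ∑-comm : ∀ {m l} (f : Fin m → Fin l → ℚ) → ∑ (λ i → ∑ (f i)) ≡ ∑ (λ j → ∑ (λ i → f i j))
  ∑-comm f = begin
    ∑ (λ i → ∑ (f i))                  ≡⟨ ∑-cong (λ i → ∑≡sum (f i)) ⟩
    ∑ (λ i → S.sum (f i))              ≡⟨ ∑≡sum (λ i → S.sum (f i)) ⟩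
    S.sum (λ i → S.sum (f i))          ≡⟨ S.∑-comm f ⟩
    S.sum (λ j → S.sum (λ i → f i j))  ≡⟨ ∑≡sum (λ j → S.sum (λ i → f i j)) ⟨
    ∑ (λ j → S.sum (λ i → f i j))      ≡⟨ ∑-cong (λ j → ∑≡sum (λ i → f i j)) ⟨
    ∑ (λ j → ∑ (λ i → f i j))          ∎
    where open ≡-Reasoning

  ∑-init-last : ∀ {m} (f : Fin (suc m) → ℚ) → ∑ f ≡ ∑ (f ∘ inject₁) + f (fromℕ m)
  ∑-init-last f = begin
    ∑ f                              ≡⟨ ∑≡sum f ⟩
    S.sum f                          ≡⟨ S.sum-init-last f ⟩
    S.sum (f ∘ inject₁) + f (fromℕ _) ≡⟨ cong (_+ f (fromℕ _)) (∑≡sum (f ∘ inject₁)) ⟨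
    ∑ (f ∘ inject₁) + f (fromℕ _)     ∎
    where open ≡-Reasoning

  ∑-↑ : ∀ m {l} (f : Fin (m ℕ.+ l) → ℚ) → ∑ f ≡ ∑ (λ i → f (i ↑ˡ l)) + ∑ (λ i → f (m ↑ʳ i))
  ∑-↑ zero    f = sym (+-identityˡ _)
  ∑-↑ (suc m) f = trans (cong (f zero +_) (∑-↑ m (f ∘ suc))) (sym (+-assoc (f zero) _ _))

  ∑-neg : ∀ {m} (f : Fin m → ℚ) → ∑ (λ i → - f i) ≡ - ∑ f
  ∑-neg {zero}  f = refl
  ∑-neg {suc m} f = trans (cong (- f zero +_) (∑-neg (f ∘ suc))) (sym (neg-distrib-+ (f zero) _))

  ∑-distrib-- : ∀ {m} (f g : Fin m → ℚ) → ∑ (λ i → f i - g i) ≡ ∑ f - ∑ g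
  ∑-distrib-- f g = trans (∑-distrib-+ f (λ i → - g i)) (cong (∑ f +_) (∑-neg g))

  ∑-supported : ∀ {m} (f : Fin m → ℚ) i → (∀ j → j ≢ i → f j ≡ 0ℚ) → ∑ f ≡ f i
  ∑-supported {suc m} f zero    off = begin
    f zero + ∑ (f ∘ suc)          ≡⟨ cong (f zero +_) (∑-cong (λ j → off (suc j) λ ())) ⟩
    f zero + ∑ {m} (λ _ → 0ℚ)    ≡⟨ cong (f zero +_) (∑-zero m) ⟩
    f zero + 0ℚ                   ≡⟨ +-identityʳ (f zero) ⟩
    f zero                        ∎
    where open ≡-Reasoning
  ∑-supported {suc m} f (suc i) off = begin
    f zero + ∑ (f ∘ suc)
      ≡⟨ cong₂ _+_ (off zero λ ()) (∑-supported (f ∘ suc) i (λ j j≢i → off (suc j) (j≢i ∘ Fin.suc-injective))) ⟩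
    0ℚ + f (suc i)        ≡⟨ +-identityˡ (f (suc i)) ⟩
    f (suc i)             ∎
    where open ≡-Reasoning

  ∑-const : ∀ m (c : ℚ) → ∑ {m} (λ _ → c) ≡ ι (ℤ.+ m) * c
  ∑-const zero    c = sym (*-zeroˡ c)
  ∑-const (suc m) c = begin
    c + ∑ {m} (λ _ → c)   ≡⟨ cong (c +_) (∑-const m c) ⟩
    c + ι (ℤ.+ m) * c       ≡⟨ cong (_+ ι (ℤ.+ m) * c) (*-identityˡ c) ⟨
    1ℚ * c + ι (ℤ.+ m) * c  ≡⟨ *-distribʳ-+ c 1ℚ (ι (ℤ.+ m)) ⟨
    (1ℚ + ι (ℤ.+ m)) * c    ≡⟨ cong (_* c) (ι-+ (ℤ.+ 1) (ℤ.+ m)) ⟨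
    ι (ℤ.+ suc m) * c       ∎
    where open ≡-Reasoning

  ∑-0* : ∀ {m} (f : Fin m → ℚ) → ∑ (λ i → 0ℚ * f i) ≡ 0ℚ
  ∑-0* f = trans (sym (*-distribˡ-∑ 0ℚ f)) (*-zeroˡ (∑ f))

  ∑-mono-≤ : ∀ {m} {f g : Fin m → ℚ} → (∀ i → f i ≤ g i) → ∑ f ≤ ∑ g
  ∑-mono-≤ {zero}  f≤g = ≤-refl
  ∑-mono-≤ {suc m} f≤g = +-mono-≤ (f≤g zero) (∑-mono-≤ (f≤g ∘ suc))

  *-pres-0≤ : ∀ {a b} → 0ℚ ≤ a → 0ℚ ≤ b → 0ℚ ≤ a * b
  *-pres-0≤ {a} {b} 0≤a 0≤b = nonNegative⁻¹ _ {{nonNeg*nonNeg⇒nonNeg a {{nonNegative 0≤a}} b {{nonNegative 0≤b}}}}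

  *-pres-0< : ∀ {a b} → 0ℚ < a → 0ℚ < b → 0ℚ < a * b
  *-pres-0< {a} {b} 0<a 0<b = positive⁻¹ _ {{pos*pos⇒pos a {{positive 0<a}} b {{positive 0<b}}}}

  ∑-nonNeg : ∀ {m} (f : Fin m → ℚ) → (∀ i → 0ℚ ≤ f i) → 0ℚ ≤ ∑ f
  ∑-nonNeg {zero}  f h = ≤-refl
  ∑-nonNeg {suc m} f h = +-mono-≤ (h zero) (∑-nonNeg (f ∘ suc) (h ∘ suc))

  term≤∑ : ∀ {m} (f : Fin m → ℚ) → (∀ i → 0ℚ ≤ f i) → ∀ i → f i ≤ ∑ f
  term≤∑ {suc m} f h zero    =
    subst (_≤ ∑ f) (+-identityʳ (f zero)) (+-monoʳ-≤ (f zero) (∑-nonNeg (f ∘ suc) (h ∘ suc)))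
  term≤∑ {suc m} f h (suc i) =
    ≤-trans (term≤∑ (f ∘ suc) (h ∘ suc) i) (subst (_≤ ∑ f) (+-identityˡ _) (+-monoˡ-≤ (∑ (f ∘ suc)) (h zero)))

  ∑≡0⇒term≡0 : ∀ {m} (f : Fin m → ℚ) → (∀ i → 0ℚ ≤ f i) → ∑ f ≡ 0ℚ → ∀ i → f i ≡ 0ℚ
  ∑≡0⇒term≡0 f h ∑f≡0 i = ≤-antisym (subst (f i ≤_) ∑f≡0 (term≤∑ f h i)) (h i)

  ∑-pos⇒∃pos : ∀ {m} (f : Fin m → ℚ) → 0ℚ < ∑ f → ∃ λ i → 0ℚ < f i
  ∑-pos⇒∃pos {zero}  f 0<0 = ⊥-elim (<-irrefl refl 0<0)
  ∑-pos⇒∃pos {suc m} f 0<∑ with 0ℚ <? f zero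
  ... | yes 0<f₀ = zero , 0<f₀
  ... | no  0≮f₀ = let i , 0<fᵢ = ∑-pos⇒∃pos (f ∘ suc) 0<∑rest in suc i , 0<fᵢ
    where
    0<∑rest : 0ℚ < ∑ (f ∘ suc)
    0<∑rest = <-≤-trans 0<∑
      (subst (f zero + ∑ (f ∘ suc) ≤_) (+-identityˡ _) (+-monoˡ-≤ (∑ (f ∘ suc)) (≮⇒≥ 0≮f₀)))

  IsInt-+ : ∀ {p q} → IsInt p → IsInt q → IsInt (p + q)
  IsInt-+ (a , refl) (b , refl) = a ℤ.+ b , sym (ι-+ a b)

  IsInt-* : ∀ {p q} → IsInt p → IsInt q → IsInt (p * q)
  IsInt-* (a , refl) (b , refl) = a ℤ.* b , sym (ι-* a b)

  IsInt-neg : ∀ {p} → IsInt p → IsInt (- p)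
  IsInt-neg (a , refl) = ℤ.- a , sym (ι-neg a)

  IsInt-- : ∀ {p q} → IsInt p → IsInt q → IsInt (p - q)
  IsInt-- x y = IsInt-+ x (IsInt-neg y)

  IsInt-∑ : ∀ {m} (f : Fin m → ℚ) → (∀ i → IsInt (f i)) → IsInt (∑ f)
  IsInt-∑ {zero}  f h = ℤ.+ 0 , refl
  IsInt-∑ {suc m} f h = IsInt-+ (h zero) (IsInt-∑ (f ∘ suc) (h ∘ suc))

  IsInt-<⇒+1≤ : ∀ {x y} → IsInt x → IsInt y → x < y → x + 1ℚ ≤ y
  IsInt-<⇒+1≤ (a , refl) (b , refl) x<y =
    subst (_≤ ι b) (trans (ι-+ (ℤ.+ 1) a) (+-comm 1ℚ (ι a)))
      (ι-mono-≤ (ℤ.+ 1 ℤ.+ a) b (ℤ.i<j⇒suc[i]≤j (ι-cancel-< a b x<y)))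

  IsInt->-1⇒nonNeg : ∀ {x} → IsInt x → - 1ℚ < x → 0ℚ ≤ x
  IsInt->-1⇒nonNeg {x} x-int -1<x =
    subst (_≤ x) (+-inverseˡ 1ℚ) (IsInt-<⇒+1≤ (ℤ.- ℤ.+ 1 , refl) x-int -1<x)

  IsInt-between-±1⇒0 : ∀ {x} → IsInt x → - 1ℚ < x → x < 1ℚ → x ≡ 0ℚ
  IsInt-between-±1⇒0 {x} x-int -1<x x<1 = ≤-antisym x≤0 (IsInt->-1⇒nonNeg x-int -1<x)
    where
    x≤0 : x ≤ 0ℚ
    x≤0 = subst (_≤ 0ℚ) (+-identityʳ x)
            (subst₂ _≤_ (+-assoc x 1ℚ (- 1ℚ)) (+-inverseʳ 1ℚ)
              (+-monoˡ-≤ (- 1ℚ) (IsInt-<⇒+1≤ x-int (ℤ.+ 1 , refl) x<1)))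

  IsInt-diff⇒≡ : ∀ {x y} → 0ℚ ≤ x → x < 1ℚ → 0ℚ ≤ y → y < 1ℚ → IsInt (x - y) → x ≡ y
  IsInt-diff⇒≡ {x} {y} 0≤x x<1 0≤y y<1 d-int = begin
    x            ≡⟨ identity x y ⟩
    (x - y) + y  ≡⟨ cong (_+ y) (IsInt-between-±1⇒0 d-int -1<x-y x-y<1) ⟩
    0ℚ + y       ≡⟨ +-identityˡ y ⟩
    y            ∎
    where
    open ≡-Reasoning
    identity : ∀ x y → x ≡ (x - y) + y
    identity = solve-∀ ℚ-ring
    -1<x-y : - 1ℚ < x - y
    -1<x-y = <-≤-trans (neg-antimono-< y<1) (subst (_≤ x - y) (+-identityˡ (- y)) (+-monoˡ-≤ (- y) 0≤x))
    x-y<1 : x - y < 1ℚ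
    x-y<1 = ≤-<-trans (subst (x - y ≤_) (+-identityʳ x) (+-monoʳ-≤ x (neg-antimono-≤ 0≤y))) x<1

  half-injective : ∀ {x y} → x + x ≡ y + y → x ≡ y
  half-injective {x} {y} e = trans (halve x) (trans (cong (_* ½) e) (sym (halve y)))
    where
    halve : ∀ x → x ≡ (x + x) * ½
    halve = solve-∀ ℚ-ring

  IsInt-double : ∀ {x} → IsInt (x + x) → IsInt x ⊎ IsInt (x - ½)
  IsInt-double {x} (m , x+x≡m) with m ℤ.% ℤ.+ 2 | ℤ.n%d<d m (ℤ.+ 2) | ℤ.a≡a%n+[a/n]*n m (ℤ.+ 2)
  ... | 0 | _ | m≡ = inj₁ (q , half-injective (begin
    x + x                 ≡⟨ x+x≡m ⟩
    ι m                   ≡⟨ cong ι (trans m≡ (even q)) ⟩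
    ι (q ℤ.+ q)           ≡⟨ ι-+ q q ⟩
    ι q + ι q             ∎))
    where
    open ≡-Reasoning
    q = m ℤ./ ℤ.+ 2
    even : ∀ q → ℤ.+ 0 ℤ.+ q ℤ.* ℤ.+ 2 ≡ q ℤ.+ q
    even = ℤ.solve-∀
  ... | 1 | _ | m≡ = inj₂ (q , half-injective (begin
    (x - ½) + (x - ½)     ≡⟨ shift x ⟩
    (x + x) - 1ℚ          ≡⟨ cong (_- 1ℚ) x+x≡m ⟩
    ι m - 1ℚ              ≡⟨ cong (λ t → ι t - 1ℚ) (trans m≡ (odd q)) ⟩
    ι (ℤ.+ 1 ℤ.+ (q ℤ.+ q)) - 1ℚ  ≡⟨ cong (_- 1ℚ) (trans (ι-+ (ℤ.+ 1) (q ℤ.+ q)) (cong (1ℚ +_) (ι-+ q q))) ⟩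
    (1ℚ + (ι q + ι q)) - 1ℚ       ≡⟨ cancel (ι q + ι q) ⟩
    ι q + ι q             ∎))
    where
    open ≡-Reasoning
    q = m ℤ./ ℤ.+ 2
    odd : ∀ q → ℤ.+ 1 ℤ.+ q ℤ.* ℤ.+ 2 ≡ ℤ.+ 1 ℤ.+ (q ℤ.+ q)
    odd = ℤ.solve-∀
    shift : ∀ x → (x - ½) + (x - ½) ≡ (x + x) - 1ℚ
    shift = solve-∀ ℚ-ring
    cancel : ∀ a → (1ℚ + a) - 1ℚ ≡ a
    cancel = solve-∀ ℚ-ring
  ... | suc (suc _) | ℕ.s≤s (ℕ.s≤s ()) | _

  ½<1 : ½ < 1ℚ
  ½<1 = toWitness {a? = ½ <? 1ℚ} _

  -1<-½ : - 1ℚ < - ½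
  -1<-½ = toWitness {a? = - 1ℚ <? - ½} _

  IsInt-<⇒+½< : ∀ {u v} → IsInt u → IsInt v → u < v → u + ½ < v
  IsInt-<⇒+½< {u} u-int v-int u<v =
    <-≤-trans (+-monoʳ-< u ½<1) (IsInt-<⇒+1≤ u-int v-int u<v)

  IsInt-[-½]⇒½≤ : ∀ {u} → IsInt (u - ½) → 0ℚ ≤ u → ½ ≤ u
  IsInt-[-½]⇒½≤ {u} d-int 0≤u = subst₂ _≤_ (+-identityˡ ½) (identity u) (+-monoˡ-≤ ½ 0≤d)
    where
    identity : ∀ u → u - ½ + ½ ≡ u
    identity = solve-∀ ℚ-ring
    -1<d : - 1ℚ < u - ½
    -1<d = <-≤-trans -1<-½ (subst (_≤ u - ½) (+-identityˡ (- ½)) (+-monoˡ-≤ (- ½) 0≤u))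
    0≤d : 0ℚ ≤ u - ½
    0≤d = IsInt->-1⇒nonNeg d-int -1<d

  fromBool : Bool → ℚ
  fromBool true  = 1ℚ
  fromBool false = 0ℚ

  fromBool-nonNeg : ∀ b → 0ℚ ≤ fromBool b
  fromBool-nonNeg true  = toWitness {a? = 0ℚ ≤? 1ℚ} _
  fromBool-nonNeg false = ≤-refl

  ι-countT : ∀ {l} (f : Fin l → Bool) → ι (ℤ.+ countT f) ≡ ∑ (fromBool ∘ f)
  ι-countT {zero}  f = refl
  ι-countT {suc l} f = trans (ι-+ (ℤ.+ b2ℕ (f zero)) (ℤ.+ countT (f ∘ suc)))
                             (cong₂ _+_ (ι-b2ℕ (f zero)) (ι-countT (f ∘ suc)))
    where
    ι-b2ℕ : ∀ b → ι (ℤ.+ b2ℕ b) ≡ fromBool b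
    ι-b2ℕ true  = refl
    ι-b2ℕ false = refl

  ≡ᵇ-true : ∀ {m n} → m ≡ n → (m ℕ.≡ᵇ n) ≡ true
  ≡ᵇ-true {m} {n} m≡n = Equivalence.to T-≡ (ℕ.≡⇒≡ᵇ m n m≡n)

  ≡ᵇ-false : ∀ {m n} → m ≢ n → (m ℕ.≡ᵇ n) ≡ false
  ≡ᵇ-false {m} {n} m≢n with m ℕ.≡ᵇ n in e
  ... | false = refl
  ... | true  = ⊥-elim (m≢n (ℕ.≡ᵇ⇒≡ m n (Equivalence.from T-≡ e)))

  eqFin-refl : ∀ {m} (i : Fin m) → eqFin i i ≡ true
  eqFin-refl i = ≡ᵇ-true {toℕ i} refl

  eqFin-≢ : ∀ {m} {i j : Fin m} → i ≢ j → eqFin i j ≡ false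
  eqFin-≢ i≢j = ≡ᵇ-false (i≢j ∘ Fin.toℕ-injective)

  isLast-inject₁ : ∀ {d} (k : Fin d) → isLast (inject₁ k) ≡ false
  isLast-inject₁ {d} k = ≡ᵇ-false (ℕ.<⇒≢ (subst (ℕ._< d) (sym (Fin.toℕ-inject₁ k)) (Fin.toℕ<n k)))

  isLast-fromℕ : ∀ d → isLast (fromℕ d) ≡ true
  isLast-fromℕ d = ≡ᵇ-true (Fin.toℕ-fromℕ d)

  isLast-≢ : ∀ {d} {i : Fin (suc d)} → i ≢ fromℕ d → isLast i ≡ false
  isLast-≢ {d} {i} i≢last = ≡ᵇ-false (λ i≡d → i≢last (Fin.toℕ-injective (trans i≡d (sym (Fin.toℕ-fromℕ d)))))

  ∑-isLast : ∀ {d} (f : Fin (suc d) → ℚ) → ∑ (λ i → fromBool (isLast i) * f i) ≡ f (fromℕ d)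
  ∑-isLast {d} f = begin
    ∑ (λ i → fromBool (isLast i) * f i)
      ≡⟨ ∑-supported _ (fromℕ d) (λ i i≢last →
           trans (cong (λ b → fromBool b * f i) (isLast-≢ i≢last)) (*-zeroˡ (f i))) ⟩
    fromBool (isLast (fromℕ d)) * f (fromℕ d) ≡⟨ cong (λ b → fromBool b * f (fromℕ d)) (isLast-fromℕ d) ⟩
    1ℚ * f (fromℕ d)                       ≡⟨ *-identityˡ (f (fromℕ d)) ⟩
    f (fromℕ d)                            ∎
    where open ≡-Reasoning

  δ : ∀ {m} → Fin m → Fin m → ℚ
  δ i j = fromBool (eqFin i j)

  ∑-*δ : ∀ {m} (f : Fin m → ℚ) i → ∑ (λ j → f j * δ i j) ≡ f i
  ∑-*δ f i = begin
    ∑ (λ j → f j * δ i j)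
      ≡⟨ ∑-supported _ i (λ j j≢i → trans (cong (λ b → f j * fromBool b) (eqFin-≢ (j≢i ∘ sym))) (*-zeroʳ (f j))) ⟩
    f i * δ i i            ≡⟨ cong (λ b → f i * fromBool b) (eqFin-refl i) ⟩
    f i * 1ℚ               ≡⟨ *-identityʳ (f i) ⟩
    f i                    ∎
    where open ≡-Reasoning

  _∙_ : ∀ {d} → (Fin d → ℚ) → (Fin d → ℚ) → ℚ
  x ∙ y = ∑ (λ k → x k * y k)

  ∙-comm : ∀ {d} (x y : Fin d → ℚ) → x ∙ y ≡ y ∙ x
  ∙-comm x y = ∑-cong (λ k → *-comm (x k) (y k))

  ·-∙ : ∀ {r d} (μ : Fin r → ℚ) (M : Fin r → Fin d → ℚ) (y : Fin d → ℚ) →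
        (μ · M) ∙ y ≡ ∑ (λ s → μ s * (M s ∙ y))
  ·-∙ μ M y = begin
    ∑ (λ k → ∑ (λ s → μ s * M s k) * y k)  ≡⟨ ∑-cong (λ k → *-distribʳ-∑ (y k) (λ s → μ s * M s k)) ⟩
    ∑ (λ k → ∑ (λ s → μ s * M s k * y k))  ≡⟨ ∑-comm (λ k s → μ s * M s k * y k) ⟩
    ∑ (λ s → ∑ (λ k → μ s * M s k * y k))  ≡⟨ ∑-cong (λ s → ∑-cong (λ k → *-assoc (μ s) (M s k) (y k))) ⟩
    ∑ (λ s → ∑ (λ k → μ s * (M s k * y k))) ≡⟨ ∑-cong (λ s → *-distribˡ-∑ (μ s) (λ k → M s k * y k)) ⟨
    ∑ (λ s → μ s * (M s ∙ y))              ∎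
    where open ≡-Reasoning

  ·-congˡ : ∀ {r c} {μ ν : Fin r → ℚ} (M : Fin r → Fin c → ℚ) → (∀ i → μ i ≡ ν i) →
            ∀ j → (μ · M) j ≡ (ν · M) j
  ·-congˡ M μ≗ν j = ∑-cong (λ i → cong (_* M i j) (μ≗ν i))

  ∑-*-diff : ∀ {m} (a z : Fin m → ℚ) (y : ℚ) → ∑ (λ j → a j * (y - z j)) ≡ ∑ a * y - a ∙ z
  ∑-*-diff a z y = begin
    ∑ (λ j → a j * (y - z j))           ≡⟨ ∑-cong (λ j → *-distribˡ-+ (a j) y (- z j)) ⟩
    ∑ (λ j → a j * y + a j * - z j)     ≡⟨ ∑-distrib-+ (λ j → a j * y) (λ j → a j * - z j) ⟩
    ∑ (λ j → a j * y) + ∑ (λ j → a j * - z j)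
        ≡⟨ cong₂ _+_ (*-distribʳ-∑ y a) (∑-cong (λ j → neg-distribʳ-* (a j) (z j))) ⟨
    ∑ a * y + ∑ (λ j → - (a j * z j))  ≡⟨ cong (∑ a * y +_) (∑-neg (λ j → a j * z j)) ⟩
    ∑ a * y - a ∙ z                     ∎
    where open ≡-Reasoning

  InConv-vertex : ∀ {r d} (pts : Fin r → Fin d → ℚ) s → InConv pts (pts s)
  InConv-vertex pts s = δ s , (λ t → fromBool-nonNeg (eqFin s t)) , ∑δ , λ k → sym (picks k)
    where
    ∑δ : ∑ (δ s) ≡ 1ℚ
    ∑δ = trans (∑-cong (λ t → sym (*-identityˡ (δ s t)))) (∑-*δ (λ _ → 1ℚ) s)
    picks : ∀ k → ∑ (λ t → δ s t * pts t k) ≡ pts s k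
    picks k = trans (∑-cong (λ t → *-comm (δ s t) (pts t k))) (∑-*δ (λ t → pts t k) s)

  vertices-bound⇒Dual : ∀ {r d} (pts : Fin r → Fin d → ℚ) y →
                        (∀ s → - 1ℚ ≤ pts s ∙ y) → Dual (InConv pts) y
  vertices-bound⇒Dual pts y bound x (μ , 0≤μ , ∑μ≡1 , x≡) = begin
    - 1ℚ                              ≡⟨ trans (cong (λ t → t * - 1ℚ) ∑μ≡1) (*-identityˡ (- 1ℚ)) ⟨
    ∑ μ * - 1ℚ                        ≡⟨ *-distribʳ-∑ (- 1ℚ) μ ⟩
    ∑ (λ s → μ s * - 1ℚ)              ≤⟨ ∑-mono-≤ (λ s → *-monoˡ-≤-nonNeg (μ s) {{nonNegative (0≤μ s)}} (bound s)) ⟩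
    ∑ (λ s → μ s * (pts s ∙ y))       ≡⟨ ·-∙ μ pts y ⟨
    (μ · pts) ∙ y                     ≡⟨ ∑-cong (λ k → cong (_* y k) (x≡ k)) ⟨
    x ∙ y                             ∎
    where open ≤-Reasoning

  Dual-vertex : ∀ {r d} (pts : Fin r → Fin d → ℚ) {y} → Dual (InConv pts) y → ∀ s → - 1ℚ ≤ pts s ∙ y
  Dual-vertex pts y-in-dual s = y-in-dual (pts s) (InConv-vertex pts s)

  convex-tight : ∀ {r d} (P : Fin r → Fin d → ℚ) (ν : Fin r → ℚ) (v : Fin d → ℚ) →
                 (∀ s → 0ℚ ≤ ν s) → ∑ ν ≡ 1ℚ → (∀ s → - 1ℚ ≤ v ∙ P s) → v ∙ (ν · P) ≡ - 1ℚ →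
                 ∀ s → 0ℚ < ν s → v ∙ P s ≡ - 1ℚ
  convex-tight P ν v 0≤ν ∑ν≡1 bound tight s 0<νs = begin
    v ∙ P s                  ≡⟨ identity (v ∙ P s) ⟩
    slack s - 1ℚ             ≡⟨ cong (_- 1ℚ) slack≡0 ⟩
    0ℚ - 1ℚ                  ≡⟨ +-identityˡ (- 1ℚ) ⟩
    - 1ℚ                     ∎
    where
    open ≡-Reasoning
    identity : ∀ c → c ≡ c + 1ℚ - 1ℚ
    identity = solve-∀ ℚ-ring
    slack : Fin _ → ℚ
    slack t = v ∙ P t + 1ℚ
    0≤slack : ∀ t → 0ℚ ≤ slack t
    0≤slack t = subst (_≤ slack t) (+-inverseˡ 1ℚ) (+-monoˡ-≤ 1ℚ (bound t))
    ∑ν-slack : ∑ (λ t → ν t * slack t) ≡ 0ℚ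
    ∑ν-slack = begin
      ∑ (λ t → ν t * slack t)                        ≡⟨ ∑-cong (λ t → *-distribˡ-+ (ν t) (v ∙ P t) 1ℚ) ⟩
      ∑ (λ t → ν t * (v ∙ P t) + ν t * 1ℚ)           ≡⟨ ∑-distrib-+ (λ t → ν t * (v ∙ P t)) (λ t → ν t * 1ℚ) ⟩
      ∑ (λ t → ν t * (v ∙ P t)) + ∑ (λ t → ν t * 1ℚ)
        ≡⟨ cong₂ _+_ (∑-cong (λ t → cong (ν t *_) (∙-comm v (P t))))
                     (trans (∑-cong (λ t → *-identityʳ (ν t))) ∑ν≡1) ⟩
      ∑ (λ t → ν t * (P t ∙ v)) + 1ℚ                 ≡⟨ cong (_+ 1ℚ) (·-∙ ν P v) ⟨
      (ν · P) ∙ v + 1ℚ                                ≡⟨ cong (_+ 1ℚ) (trans (∙-comm (ν · P) v) tight) ⟩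
      - 1ℚ + 1ℚ                                       ≡⟨ +-inverseˡ 1ℚ ⟩
      0ℚ                                              ∎
    νs-slack≡0 : ν s * slack s ≡ 0ℚ
    νs-slack≡0 = ∑≡0⇒term≡0 (λ t → ν t * slack t) (λ t → *-pres-0≤ (0≤ν t) (0≤slack t)) ∑ν-slack s
    slack≡0 : slack s ≡ 0ℚ
    slack≡0 = ≤-antisym
      (*-cancelˡ-≤-pos (ν s) {{positive 0<νs}} (subst₂ _≤_ (sym νs-slack≡0) (sym (*-zeroʳ (ν s))) ≤-refl))
      (0≤slack s)

  data PositiveWalk {m} (w : Fin m → Fin m → ℚ) : Fin m → Fin m → Set where
    here : ∀ {i} → PositiveWalk w i i
    step : ∀ {i j l} → 0ℚ < w i j → PositiveWalk w j l → PositiveWalk w i l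

  record ConnectedWeights (m : ℕ) : Set where
    field
      weight        : Fin m → Fin m → ℚ
      weight-sym    : ∀ i j → weight i j ≡ weight j i
      weight-nonNeg : ∀ i j → 0ℚ ≤ weight i j
      connected     : ∀ i j → PositiveWalk weight i j

  weightedLaplacian : ∀ {m} → (Fin m → Fin m → ℚ) → (Fin m → ℚ) → Fin m → ℚ
  weightedLaplacian w x i = ∑ (λ j → w i j * (x i - x j))

  LaplacianSolvable : ℕ → Set
  LaplacianSolvable m = (W : ConnectedWeights m) (b : Fin m → ℚ) → ∑ b ≡ 0ℚ →
    ∃ λ x → ∀ i → weightedLaplacian (ConnectedWeights.weight W) x i ≡ b i

  module KronReduction {k} (W : ConnectedWeights (suc (suc k))) where

    open ConnectedWeights W renaming (weight to w)

    w₀ : Fin (suc k) → ℚ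
    w₀ j = w zero (suc j)

    d₀ : ℚ
    d₀ = ∑ w₀

    walk⇒0<d₀ : ∀ {t} → PositiveWalk w zero (suc t) → 0ℚ < d₀
    walk⇒0<d₀ (step {j = zero}  _     walk) = walk⇒0<d₀ walk
    walk⇒0<d₀ (step {j = suc c} 0<w₀c _)    = <-≤-trans 0<w₀c (term≤∑ _ (weight-nonNeg zero ∘ suc) c)

    0<d₀ : 0ℚ < d₀
    0<d₀ = walk⇒0<d₀ (connected zero (suc zero))

    instance
      d₀≢0 : NonZero d₀
      d₀≢0 = pos⇒nonZero d₀ {{positive 0<d₀}}

    q : ℚ
    q = 1/ d₀

    d₀q≡1 : d₀ * q ≡ 1ℚ
    d₀q≡1 = *-inverseʳ d₀

    0<q : 0ℚ < q
    0<q = positive⁻¹ q {{1/pos⇒pos d₀ {{positive 0<d₀}}}}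

    -- Eliminating vertex 0 (Schur complement): a path i – 0 – j becomes an edge of weight w i 0 · w 0 j / d₀.
    w′ : Fin (suc k) → Fin (suc k) → ℚ
    w′ i j = w (suc i) (suc j) + w (suc i) zero * w zero (suc j) * q

    w≤w′ : ∀ i j → w (suc i) (suc j) ≤ w′ i j
    w≤w′ i j = subst (_≤ w′ i j) (+-identityʳ _)
      (+-monoʳ-≤ (w (suc i) (suc j)) (*-pres-0≤ (*-pres-0≤ (weight-nonNeg _ _) (weight-nonNeg _ _)) (<⇒≤ 0<q)))

    mutual
      reduce-walk : ∀ {a c} → PositiveWalk w (suc a) (suc c) → PositiveWalk w′ a c
      reduce-walk here                          = here
      reduce-walk (step {j = zero}  0<wa₀ walk) = reduce-walk-via₀ 0<wa₀ walk
      reduce-walk (step {j = suc t} 0<wat walk) = step (<-≤-trans 0<wat (w≤w′ _ _)) (reduce-walk walk)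

      reduce-walk-via₀ : ∀ {a c} → 0ℚ < w (suc a) zero → PositiveWalk w zero (suc c) → PositiveWalk w′ a c
      reduce-walk-via₀ 0<wa₀ (step {j = zero}  _     walk) = reduce-walk-via₀ 0<wa₀ walk
      reduce-walk-via₀ {a} 0<wa₀ (step {j = suc t} 0<w₀t walk) =
        step (subst (_< w′ a t) (+-identityˡ 0ℚ) (+-mono-≤-< (weight-nonNeg _ _) (*-pres-0< (*-pres-0< 0<wa₀ 0<w₀t) 0<q)))
             (reduce-walk walk)

    reduced : ConnectedWeights (suc k)
    reduced = record
      { weight        = w′
      ; weight-sym    = λ i j → cong₂ _+_ (weight-sym (suc i) (suc j))
          (cong (_* q) (trans (cong₂ _*_ (weight-sym (suc i) zero) (weight-sym zero (suc j)))
                              (*-comm (w zero (suc i)) (w (suc j) zero))))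
      ; weight-nonNeg = λ i j → ≤-trans (weight-nonNeg (suc i) (suc j)) (w≤w′ i j)
      ; connected     = λ i j → reduce-walk (connected (suc i) (suc j))
      }

    reduced-Laplacian : ∀ x′ i → weightedLaplacian w′ x′ i ≡
      ∑ (λ j → w (suc i) (suc j) * (x′ i - x′ j)) + w (suc i) zero * q * (d₀ * x′ i - w₀ ∙ x′)
    reduced-Laplacian x′ i = begin
      ∑ (λ j → w′ i j * (y - x′ j))
        ≡⟨ ∑-cong (λ j → *-distribʳ-+ (y - x′ j) (w (suc i) (suc j)) (a * w₀ j * q)) ⟩
      ∑ (λ j → w (suc i) (suc j) * (y - x′ j) + a * w₀ j * q * (y - x′ j))
        ≡⟨ ∑-distrib-+ (λ j → w (suc i) (suc j) * (y - x′ j)) (λ j → a * w₀ j * q * (y - x′ j)) ⟩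
      S + ∑ (λ j → a * w₀ j * q * (y - x′ j))
        ≡⟨ cong (S +_) (∑-cong (λ j → regroup a (w₀ j) q (y - x′ j))) ⟩
      S + ∑ (λ j → a * q * (w₀ j * (y - x′ j)))
        ≡⟨ cong (S +_) (*-distribˡ-∑ (a * q) (λ j → w₀ j * (y - x′ j))) ⟨
      S + a * q * ∑ (λ j → w₀ j * (y - x′ j))
        ≡⟨ cong (λ t → S + a * q * t) (∑-*-diff w₀ x′ y) ⟩
      S + a * q * (d₀ * y - w₀ ∙ x′)  ∎
      where
      open ≡-Reasoning
      a = w (suc i) zero
      y = x′ i
      S = ∑ (λ j → w (suc i) (suc j) * (y - x′ j))
      regroup : ∀ a c q e → a * c * q * e ≡ a * q * (c * e)
      regroup = solve-∀ ℚ-ring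

    module _ (b : Fin (suc (suc k)) → ℚ) where

      -- Solving the equation at vertex 0 for x₀ = (b₀ + w₀ ∙ x′) / d₀ and substituting it into the
      -- other equations gives the reduced system weightedLaplacian w′ x′ = b′.
      b′ : Fin (suc k) → ℚ
      b′ i = b (suc i) + w (suc i) zero * b zero * q

      ∑b′≡0 : ∑ b ≡ 0ℚ → ∑ b′ ≡ 0ℚ
      ∑b′≡0 ∑b≡0 = begin
        ∑ b′                                             ≡⟨ ∑-distrib-+ (b ∘ suc) (λ i → w (suc i) zero * b zero * q) ⟩
        B + ∑ (λ i → w (suc i) zero * b zero * q)        ≡⟨ cong (B +_) (trans (∑-cong (λ i → *-assoc (w (suc i) zero) (b zero) q))
                                                                    (sym (*-distribʳ-∑ (b zero * q) (λ i → w (suc i) zero)))) ⟩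
        B + ∑ (λ i → w (suc i) zero) * (b zero * q)
          ≡⟨ cong (λ t → B + t * (b zero * q)) (∑-cong (λ i → weight-sym (suc i) zero)) ⟩
        B + d₀ * (b zero * q)                            ≡⟨ identity B d₀ (b zero) q ⟩
        (b zero + B) + (d₀ * q - 1ℚ) * b zero            ≡⟨ cong₂ _+_ ∑b≡0 (cong (λ t → (t - 1ℚ) * b zero) d₀q≡1) ⟩
        0ℚ + (1ℚ - 1ℚ) * b zero                          ≡⟨ cancel (b zero) ⟩
        0ℚ                                               ∎
        where
        open ≡-Reasoning
        B = ∑ (b ∘ suc)
        identity : ∀ B d b₀ q → B + d * (b₀ * q) ≡ (b₀ + B) + (d * q - 1ℚ) * b₀
        identity = solve-∀ ℚ-ring
        cancel : ∀ b₀ → 0ℚ + (1ℚ - 1ℚ) * b₀ ≡ 0ℚ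
        cancel = solve-∀ ℚ-ring

      module _ (x′ : Fin (suc k) → ℚ) (x′-solves : ∀ i → weightedLaplacian w′ x′ i ≡ b′ i) where

        t₀ : ℚ
        t₀ = w₀ ∙ x′

        lift : Fin (suc (suc k)) → ℚ
        lift zero    = (b zero + t₀) * q
        lift (suc i) = x′ i

        lift-solves₀ : weightedLaplacian w lift zero ≡ b zero
        lift-solves₀ = begin
          w zero zero * (x₀ - x₀) + ∑ (λ j → w zero (suc j) * (x₀ - x′ j))
            ≡⟨ cong₂ _+_ (trans (cong (w zero zero *_) (+-inverseʳ x₀)) (*-zeroʳ (w zero zero)))
                         (∑-*-diff w₀ x′ x₀) ⟩
          0ℚ + (d₀ * ((b zero + t₀) * q) - t₀)   ≡⟨ identity d₀ (b zero) t₀ q ⟩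
          b zero + (d₀ * q - 1ℚ) * (b zero + t₀) ≡⟨ cong (λ t → b zero + (t - 1ℚ) * (b zero + t₀)) d₀q≡1 ⟩
          b zero + (1ℚ - 1ℚ) * (b zero + t₀)     ≡⟨ cancel (b zero) (b zero + t₀) ⟩
          b zero                                ∎
          where
          open ≡-Reasoning
          x₀ = lift zero
          identity : ∀ d b₀ t₀ q → 0ℚ + (d * ((b₀ + t₀) * q) - t₀) ≡ b₀ + (d * q - 1ℚ) * (b₀ + t₀)
          identity = solve-∀ ℚ-ring
          cancel : ∀ b₀ c → b₀ + (1ℚ - 1ℚ) * c ≡ b₀
          cancel = solve-∀ ℚ-ring

        lift-solves-suc : ∀ i → weightedLaplacian w lift (suc i) ≡ b (suc i)
        lift-solves-suc i = begin
          a * (y - (b zero + t₀) * q) + S           ≡⟨ identity a y (b zero) t₀ q S d₀ ⟩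
          R - a * y * (d₀ * q - 1ℚ)                ≡⟨ cong (λ t → R - a * y * (t - 1ℚ)) d₀q≡1 ⟩
          R - a * y * (1ℚ - 1ℚ)                    ≡⟨ cancel R (a * y) ⟩
          R                                        ≡⟨ cong (_- a * b zero * q) (reduced-Laplacian x′ i) ⟨
          weightedLaplacian w′ x′ i - a * b zero * q ≡⟨ cong (_- a * b zero * q) (x′-solves i) ⟩
          b′ i - a * b zero * q                    ≡⟨ cancel′ (b (suc i)) (a * b zero * q) ⟩
          b (suc i)                                ∎
          where
          open ≡-Reasoning
          a = w (suc i) zero
          y = x′ i
          S = ∑ (λ j → w (suc i) (suc j) * (y - x′ j))
          R = (S + a * q * (d₀ * y - t₀)) - a * b zero * q
          identity : ∀ a y b₀ t₀ q S d →
            a * (y - (b₀ + t₀) * q) + S ≡ ((S + a * q * (d * y - t₀)) - a * b₀ * q) - a * y * (d * q - 1ℚ)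
          identity = solve-∀ ℚ-ring
          cancel : ∀ r c → r - c * (1ℚ - 1ℚ) ≡ r
          cancel = solve-∀ ℚ-ring
          cancel′ : ∀ c e → (c + e) - e ≡ c
          cancel′ = solve-∀ ℚ-ring

        lift-solves : ∀ i → weightedLaplacian w lift i ≡ b i
        lift-solves zero    = lift-solves₀
        lift-solves (suc i) = lift-solves-suc i

  laplacian-solvable : ∀ m → LaplacianSolvable (suc m)
  laplacian-solvable zero W b ∑b≡0 = (λ _ → 0ℚ) , λ { zero → begin
    w zero zero * (0ℚ - 0ℚ) + 0ℚ  ≡⟨ cong (λ t → t + 0ℚ) (*-zeroʳ (w zero zero)) ⟩
    0ℚ + 0ℚ                       ≡⟨ ∑b≡0 ⟨
    b zero + 0ℚ                   ≡⟨ +-identityʳ (b zero) ⟩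
    b zero                        ∎ }
    where
    open ≡-Reasoning
    w = ConnectedWeights.weight W
  laplacian-solvable (suc k) W b ∑b≡0 =
    let open KronReduction W
        x′ , x′-solves = laplacian-solvable k reduced (b′ b) (∑b′≡0 b ∑b≡0)
    in lift b x′ x′-solves , lift-solves b x′ x′-solves

  module GraphLaplacian {m} (adj : Fin m → Fin m → Bool) (simple : IsSimple adj) where

    weights : Fin m → Fin m → ℚ
    weights i j = fromBool (adj i j)

    Lap-entry : ∀ i j → Lap adj i j ≡ δ i j * ∑ (weights i) - weights i j
    Lap-entry i j with i Fin.≟ j
    ... | yes refl rewrite eqFin-refl i | proj₂ simple i = begin
      ι (ℤ.+ deg adj i)              ≡⟨ ι-countT (adj i) ⟩
      ∑ (weights i)                  ≡⟨ identity (∑ (weights i)) ⟩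
      1ℚ * ∑ (weights i) - 0ℚ        ∎
      where
      open ≡-Reasoning
      identity : ∀ d → d ≡ 1ℚ * d - 0ℚ
      identity = solve-∀ ℚ-ring
    ... | no i≢j rewrite eqFin-≢ i≢j = trans (offDiagonal (adj i j)) (identity (∑ (weights i)) (weights i j))
      where
      offDiagonal : ∀ b → (if b then - 1ℚ else 0ℚ) ≡ - fromBool b
      offDiagonal true  = refl
      offDiagonal false = refl
      identity : ∀ d w → - w ≡ 0ℚ * d - w
      identity = solve-∀ ℚ-ring

    Lap-sym : ∀ i j → Lap adj i j ≡ Lap adj j i
    Lap-sym i j with i Fin.≟ j
    ... | yes refl = refl
    ... | no i≢j   = begin
      Lap adj i j                          ≡⟨ Lap-entry i j ⟩
      δ i j * ∑ (weights i) - weights i j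
        ≡⟨ cong₂ (λ b c → fromBool b * ∑ (weights i) - fromBool c) (eqFin-≢ i≢j) (proj₁ simple i j) ⟩
      0ℚ * ∑ (weights i) - weights j i
        ≡⟨ cong (_- weights j i) (trans (*-zeroˡ (∑ (weights i))) (sym (*-zeroˡ (∑ (weights j))))) ⟩
      0ℚ * ∑ (weights j) - weights j i
        ≡⟨ cong (λ b → fromBool b * ∑ (weights j) - weights j i) (eqFin-≢ (i≢j ∘ sym)) ⟨
      δ j i * ∑ (weights j) - weights j i  ≡⟨ Lap-entry j i ⟨
      Lap adj j i                          ∎
      where open ≡-Reasoning

    Lap-action : ∀ (x : Fin m → ℚ) i → ∑ (λ j → Lap adj i j * x j) ≡ weightedLaplacian weights x i
    Lap-action x i = begin
      ∑ (λ j → Lap adj i j * x j)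
        ≡⟨ ∑-cong (λ j → trans (cong (_* x j) (Lap-entry i j)) (distrib (δ i j) (∑ (weights i)) (weights i j) (x j))) ⟩
      ∑ (λ j → x j * δ i j * ∑ (weights i) - weights i j * x j)
        ≡⟨ ∑-distrib-- (λ j → x j * δ i j * ∑ (weights i)) (λ j → weights i j * x j) ⟩
      ∑ (λ j → x j * δ i j * ∑ (weights i)) - weights i ∙ x
        ≡⟨ cong (_- weights i ∙ x) (trans (sym (*-distribʳ-∑ (∑ (weights i)) (λ j → x j * δ i j)))
                                          (cong (_* ∑ (weights i)) (∑-*δ x i))) ⟩
      x i * ∑ (weights i) - weights i ∙ x
        ≡⟨ cong (_- weights i ∙ x) (*-comm (x i) _) ⟩
      ∑ (weights i) * x i - weights i ∙ x
        ≡⟨ ∑-*-diff (weights i) x (x i) ⟨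
      weightedLaplacian weights x i  ∎
      where
      open ≡-Reasoning
      distrib : ∀ e d w y → (e * d - w) * y ≡ y * e * d - w * y
      distrib = solve-∀ ℚ-ring

    column-action : ∀ (μ : Fin m → ℚ) j → (μ · Lap adj) j ≡ weightedLaplacian weights μ j
    column-action μ j = trans (∑-cong (λ r → trans (*-comm (μ r) _) (cong (_* μ r) (Lap-sym r j)))) (Lap-action μ j)

    Lap-rowSum : ∀ i → ∑ (Lap adj i) ≡ 0ℚ
    Lap-rowSum i = begin
      ∑ (Lap adj i)                                   ≡⟨ ∑-cong (λ j → *-identityʳ (Lap adj i j)) ⟨
      ∑ (λ j → Lap adj i j * 1ℚ)                      ≡⟨ Lap-action (λ _ → 1ℚ) i ⟩
      ∑ (λ j → weights i j * (1ℚ - 1ℚ))              ≡⟨ ∑-cong (λ j → *-zeroʳ (weights i j)) ⟩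
      ∑ {m} (λ _ → 0ℚ)                                ≡⟨ ∑-zero m ⟩
      0ℚ                                              ∎
      where open ≡-Reasoning

    Lap-colSum : ∀ j → ∑ (λ i → Lap adj i j) ≡ 0ℚ
    Lap-colSum j = trans (∑-cong (λ i → Lap-sym i j)) (Lap-rowSum j)

    positiveWalk : ∀ {i j} → Walk adj i j → PositiveWalk weights i j
    positiveWalk here            = here
    positiveWalk (step edge walk) =
      step (subst (λ b → 0ℚ < fromBool b) (sym edge) (toWitness {a? = 0ℚ <? 1ℚ} _)) (positiveWalk walk)

    connectedWeights : IsConnected adj → ConnectedWeights m
    connectedWeights connected = record
      { weight        = weights
      ; weight-sym    = λ i j → cong fromBool (proj₁ simple i j)
      ; weight-nonNeg = λ i j → fromBool-nonNeg (adj i j)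
      ; connected     = λ i j → positiveWalk (connected i j)
      }

  -- For a graph on suc d vertices, N d is the number of vertices and H d = 1/(2 N d) the shift of the theorem.
  N H : ℕ → ℚ
  N d = ι (ℤ.+ suc d)
  H d = ℤ.+ 1 / (suc d ℕ.+ suc d)

  0<H : ∀ d → 0ℚ < H d
  0<H d = positive⁻¹ (H d) {{normalize-pos 1 (suc d ℕ.+ suc d)}}

  N*H≡½ : ∀ d → N d * H d ≡ ½
  N*H≡½ d = half-injective (begin
    N d * H d + N d * H d          ≡⟨ *-distribʳ-+ (H d) (N d) (N d) ⟨
    (N d + N d) * H d              ≡⟨ cong (_* H d) (ι-+ (ℤ.+ suc d) (ℤ.+ suc d)) ⟨
    ι (ℤ.+ (suc d ℕ.+ suc d)) * H d ≡⟨ ι*inverse (d ℕ.+ suc d) ⟩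
    ½ + ½                          ∎)
    where open ≡-Reasoning

  augL-nonLast : ∀ {d} (adj : Fin (suc d) → Fin (suc d) → Bool) μ {j} →
                 isLast j ≡ false → (μ · augL adj) j ≡ (μ · Lap adj) j
  augL-nonLast adj μ {j} notLast = ∑-cong (λ r → cong (λ b → μ r * (if b then 1ℚ else Lap adj r j)) notLast)

  augL-isLast : ∀ {d} (adj : Fin (suc d) → Fin (suc d) → Bool) μ {j} →
                isLast j ≡ true → (μ · augL adj) j ≡ ∑ μ
  augL-isLast adj μ {j} last =
    ∑-cong (λ r → trans (cong (λ b → μ r * (if b then 1ℚ else Lap adj r j)) last) (*-identityʳ (μ r)))

  InUnitCube : ∀ {m} → (Fin m → ℚ) → Set
  InUnitCube μ = ∀ i → (0ℚ ≤ μ i) × (μ i < 1ℚ)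

  ColumnsInt : ∀ {d} → (Fin (suc d) → Fin (suc d) → Bool) → (Fin (suc d) → ℚ) → Set
  ColumnsInt adj μ = ∀ k → IsInt ((μ · vert adj) k)

  module LaplacianSimplex {d} (adj : Fin (suc d) → Fin (suc d) → Bool) (simple : IsSimple adj) where

    open GraphLaplacian adj simple

    ∑-vert-∙ : ∀ y → ∑ (λ j → vert adj j ∙ y) ≡ 0ℚ
    ∑-vert-∙ y = begin
      ∑ (λ j → ∑ (λ k → vert adj j k * y k))  ≡⟨ ∑-comm (λ j k → vert adj j k * y k) ⟩
      ∑ (λ k → ∑ (λ j → vert adj j k * y k))  ≡⟨ ∑-cong (λ k → *-distribʳ-∑ (y k) (λ j → vert adj j k)) ⟨
      ∑ (λ k → ∑ (λ j → vert adj j k) * y k)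
        ≡⟨ ∑-cong (λ k → trans (cong (_* y k) (Lap-colSum (inject₁ k))) (*-zeroˡ (y k))) ⟩
      ∑ {d} (λ _ → 0ℚ)                         ≡⟨ ∑-zero d ⟩
      0ℚ                                       ∎
      where open ≡-Reasoning

    IsFacetNormal : Fin (suc d) → (Fin d → ℚ) → Set
    IsFacetNormal i y = ∀ j → j ≢ i → vert adj j ∙ y ≡ - 1ℚ

    facetNormal-opposite : ∀ {i y} → IsFacetNormal i y → vert adj i ∙ y + 1ℚ ≡ N d
    facetNormal-opposite {i} {y} normal = begin
      vert adj i ∙ y + 1ℚ
        ≡⟨ ∑-supported (λ j → vert adj j ∙ y + 1ℚ) i
             (λ j j≢i → trans (cong (_+ 1ℚ) (normal j j≢i)) (+-inverseˡ 1ℚ)) ⟨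
      ∑ (λ j → vert adj j ∙ y + 1ℚ)             ≡⟨ ∑-distrib-+ (λ j → vert adj j ∙ y) (λ _ → 1ℚ) ⟩
      ∑ (λ j → vert adj j ∙ y) + ∑ {suc d} (λ _ → 1ℚ) ≡⟨ cong₂ _+_ (∑-vert-∙ y) (∑-const (suc d) 1ℚ) ⟩
      0ℚ + N d * 1ℚ                               ≡⟨ trans (+-identityˡ _) (*-identityʳ (N d)) ⟩
      N d                                         ∎
      where open ≡-Reasoning

    -- Rows of L sum to 0, so shifting a solution of L x = N δᵢ − 𝟙 by its last coordinate
    -- removes the contribution of the deleted column.
    rational-dualPoint : IsConnected adj → ∀ i → ∃ λ a → ∀ j → vert adj j ∙ a ≡ N d * δ i j - 1ℚ
    rational-dualPoint connected i = a , vert-∙-a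
      where
      b : Fin (suc d) → ℚ
      b j = N d * δ i j - 1ℚ

      ∑b≡0 : ∑ b ≡ 0ℚ
      ∑b≡0 = begin
        ∑ b                                         ≡⟨ ∑-distrib-- (λ j → N d * δ i j) (λ _ → 1ℚ) ⟩
        ∑ (λ j → N d * δ i j) - ∑ {suc d} (λ _ → 1ℚ)
          ≡⟨ cong₂ _-_ (∑-*δ (λ _ → N d) i) (trans (∑-const (suc d) 1ℚ) (*-identityʳ (N d))) ⟩
        N d - N d                                       ≡⟨ +-inverseʳ (N d) ⟩
        0ℚ                                          ∎
        where open ≡-Reasoning

      solution : ∃ λ x → ∀ j → ∑ (λ k → Lap adj j k * x k) ≡ b j
      solution = let x , solves = laplacian-solvable d (connectedWeights connected) b ∑b≡0
                 in x , λ j → trans (Lap-action x j) (solves j)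

      x : Fin (suc d) → ℚ
      x = proj₁ solution

      a : Fin d → ℚ
      a k = x (inject₁ k) - x (fromℕ d)

      vert-∙-a : ∀ j → vert adj j ∙ a ≡ b j
      vert-∙-a j = begin
        ∑ (λ k → Lap adj j (inject₁ k) * a k)                 ≡⟨ +-identityʳ _ ⟨
        ∑ (λ k → Lap adj j (inject₁ k) * a k) + 0ℚ
          ≡⟨ cong (vert adj j ∙ a +_)
               (trans (cong (Lap adj j (fromℕ d) *_) (+-inverseʳ xₗ)) (*-zeroʳ (Lap adj j (fromℕ d)))) ⟨
        ∑ (λ k → Lap adj j (inject₁ k) * a k) + Lap adj j (fromℕ d) * (xₗ - xₗ)
          ≡⟨ ∑-init-last (λ k → Lap adj j k * (x k - xₗ)) ⟨
        ∑ (λ k → Lap adj j k * (x k - xₗ))                    ≡⟨ ∑-cong (λ k → distrib (Lap adj j k) (x k) xₗ) ⟩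
        ∑ (λ k → Lap adj j k * x k - Lap adj j k * xₗ)
          ≡⟨ ∑-distrib-- (λ k → Lap adj j k * x k) (λ k → Lap adj j k * xₗ) ⟩
        ∑ (λ k → Lap adj j k * x k) - ∑ (λ k → Lap adj j k * xₗ)
          ≡⟨ cong₂ _-_ (proj₂ solution j) (sym (*-distribʳ-∑ xₗ (Lap adj j))) ⟩
        b j - ∑ (Lap adj j) * xₗ                               ≡⟨ cong (λ t → b j - t * xₗ) (Lap-rowSum j) ⟩
        b j - 0ℚ * xₗ                                          ≡⟨ cancel (b j) xₗ ⟩
        b j                                                    ∎
        where
        open ≡-Reasoning
        xₗ = x (fromℕ d)
        distrib : ∀ l y z → l * (y - z) ≡ l * y - l * z
        distrib = solve-∀ ℚ-ring
        cancel : ∀ c y → c - 0ℚ * y ≡ c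
        cancel = solve-∀ ℚ-ring

    augL-column : ∀ (μ : Fin (suc d) → ℚ) k → (μ · augL adj) (inject₁ k) ≡ (μ · vert adj) k
    augL-column μ k = augL-nonLast adj μ {inject₁ k} (isLast-inject₁ k)

    augL-last : ∀ (μ : Fin (suc d) → ℚ) → (μ · augL adj) (fromℕ d) ≡ ∑ μ
    augL-last μ = augL-isLast adj μ {fromℕ d} (isLast-fromℕ d)

    Λ⇔ : ∀ μ → Λ adj μ ⇔ (InUnitCube μ × IsInt (∑ μ) × ColumnsInt adj μ)
    Λ⇔ μ = mk⇔
      (λ (cube , int) → cube , subst IsInt (augL-last μ) (int (fromℕ d)) ,
                        λ k → subst IsInt (augL-column μ k) (int (inject₁ k)))
      (λ (cube , ∑-int , columns) → cube , augL-int ∑-int columns)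
      where
      augL-int : IsInt (∑ μ) → ColumnsInt adj μ → ∀ j → IsInt ((μ · augL adj) j)
      augL-int ∑-int columns j with Top.view j
      ... | Top.‵fromℕ     = subst IsInt (sym (augL-last μ)) ∑-int
      ... | Top.‵inject₁ k = subst IsInt (sym (augL-column μ k)) (columns k)

    lastColumn-int : ∀ μ → ColumnsInt adj μ → IsInt ((μ · Lap adj) (fromℕ d))
    lastColumn-int μ columns = subst IsInt last≡ (IsInt-neg (IsInt-∑ (μ · vert adj) columns))
      where
      ∑-columns : ∑ (μ · Lap adj) ≡ 0ℚ
      ∑-columns = begin
        ∑ (λ j → ∑ (λ r → μ r * Lap adj r j))  ≡⟨ ∑-comm (λ j r → μ r * Lap adj r j) ⟩
        ∑ (λ r → ∑ (λ j → μ r * Lap adj r j))  ≡⟨ ∑-cong (λ r → *-distribˡ-∑ (μ r) (Lap adj r)) ⟨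
        ∑ (λ r → μ r * ∑ (Lap adj r))           ≡⟨ ∑-cong (λ r → trans (cong (μ r *_) (Lap-rowSum r)) (*-zeroʳ (μ r))) ⟩
        ∑ {suc d} (λ _ → 0ℚ)                     ≡⟨ ∑-zero (suc d) ⟩
        0ℚ                                       ∎
        where open ≡-Reasoning
      last≡ : - ∑ (μ · vert adj) ≡ (μ · Lap adj) (fromℕ d)
      last≡ = begin
        - ∑ (μ · vert adj)
          ≡⟨ identity (∑ (μ · vert adj)) ((μ · Lap adj) (fromℕ d)) ⟩
        (μ · Lap adj) (fromℕ d) - (∑ (μ · vert adj) + (μ · Lap adj) (fromℕ d))
          ≡⟨ cong (λ t → (μ · Lap adj) (fromℕ d) - t) (trans (sym (∑-init-last (μ · Lap adj))) ∑-columns) ⟩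
        (μ · Lap adj) (fromℕ d) - 0ℚ                             ≡⟨ +-identityʳ _ ⟩
        (μ · Lap adj) (fromℕ d)                                  ∎
        where
        open ≡-Reasoning
        identity : ∀ s l → - s ≡ l - (s + l)
        identity = solve-∀ ℚ-ring

    shift-column : ∀ (μ : Fin (suc d) → ℚ) c j → ((λ r → μ r + c) · Lap adj) j ≡ (μ · Lap adj) j
    shift-column μ c j = begin
      ∑ (λ r → (μ r + c) * Lap adj r j)                         ≡⟨ ∑-cong (λ r → *-distribʳ-+ (Lap adj r j) (μ r) c) ⟩
      ∑ (λ r → μ r * Lap adj r j + c * Lap adj r j)
        ≡⟨ ∑-distrib-+ (λ r → μ r * Lap adj r j) (λ r → c * Lap adj r j) ⟩
      (μ · Lap adj) j + ∑ (λ r → c * Lap adj r j)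
        ≡⟨ cong ((μ · Lap adj) j +_) (*-distribˡ-∑ c (λ r → Lap adj r j)) ⟨
      (μ · Lap adj) j + c * ∑ (λ r → Lap adj r j)               ≡⟨ cong (λ t → (μ · Lap adj) j + c * t) (Lap-colSum j) ⟩
      (μ · Lap adj) j + c * 0ℚ
        ≡⟨ trans (cong ((μ · Lap adj) j +_) (*-zeroʳ c)) (+-identityʳ _) ⟩
      (μ · Lap adj) j                                           ∎
      where open ≡-Reasoning

    ∑-shift : ∀ (μ : Fin (suc d) → ℚ) c → ∑ (λ r → μ r + c) ≡ ∑ μ + N d * c
    ∑-shift μ c = trans (∑-distrib-+ μ (λ _ → c)) (cong (∑ μ +_) (∑-const (suc d) c))

    shift-columns : ∀ μ c → ColumnsInt adj μ → ColumnsInt adj (λ r → μ r + c)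
    shift-columns μ c columns j = subst IsInt (sym (shift-column μ c (inject₁ j))) (columns j)

    module _ (connected : IsConnected adj) (reflexive : IsReflexive (LaplacianSimplex adj)) where

      integral-facetNormal : ∀ i → ∃ λ (p : Fin d → ℤ) → IsFacetNormal i (ι ∘ p)
      integral-facetNormal i =
        p s₀ , λ j j≢i → convex-tight P ν (vert adj j) 0≤ν ∑ν≡1
                           (λ s → Dual-vertex (vert adj) (P-in-dual s) j) (pairing j j≢i) s₀ 0<νs₀
        where
        a : Fin d → ℚ
        a = proj₁ (rational-dualPoint connected i)

        vert-∙-a : ∀ j → vert adj j ∙ a ≡ N d * δ i j - 1ℚ
        vert-∙-a = proj₂ (rational-dualPoint connected i)

        dual-lattice : IsLatticePolytope (Dual (LaplacianSimplex adj))
        dual-lattice = proj₂ (proj₂ reflexive)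

        p : Fin (proj₁ dual-lattice) → Fin d → ℤ
        p = proj₁ (proj₂ dual-lattice)

        P : Fin (proj₁ dual-lattice) → Fin d → ℚ
        P s = ι ∘ p s

        dual⇔hull : ∀ y → Dual (LaplacianSimplex adj) y ⇔ InConv P y
        dual⇔hull = proj₂ (proj₂ dual-lattice)

        P-in-dual : ∀ s → Dual (LaplacianSimplex adj) (P s)
        P-in-dual s = Equivalence.from (dual⇔hull (P s)) (InConv-vertex P s)

        a-in-dual : Dual (LaplacianSimplex adj) a
        a-in-dual = vertices-bound⇒Dual (vert adj) a λ j → begin
          - 1ℚ                 ≡⟨ +-identityˡ (- 1ℚ) ⟨
          0ℚ - 1ℚ              ≤⟨ +-monoˡ-≤ (- 1ℚ) (*-pres-0≤ (<⇒≤ (0<ι+ d)) (fromBool-nonNeg (eqFin i j))) ⟩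
          N d * δ i j - 1ℚ     ≡⟨ vert-∙-a j ⟨
          vert adj j ∙ a       ∎
          where open ≤-Reasoning

        a-in-hull : InConv P a
        a-in-hull = Equivalence.to (dual⇔hull a) a-in-dual

        ν : Fin (proj₁ dual-lattice) → ℚ
        ν = proj₁ a-in-hull

        0≤ν : ∀ s → 0ℚ ≤ ν s
        0≤ν = proj₁ (proj₂ a-in-hull)

        ∑ν≡1 : ∑ ν ≡ 1ℚ
        ∑ν≡1 = proj₁ (proj₂ (proj₂ a-in-hull))

        pairing : ∀ j → j ≢ i → vert adj j ∙ (ν · P) ≡ - 1ℚ
        pairing j j≢i = begin
          vert adj j ∙ (ν · P)   ≡⟨ ∑-cong (λ k → cong (vert adj j k *_) (proj₂ (proj₂ (proj₂ a-in-hull)) k)) ⟨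
          vert adj j ∙ a         ≡⟨ vert-∙-a j ⟩
          N d * δ i j - 1ℚ       ≡⟨ cong (λ b → N d * fromBool b - 1ℚ) (eqFin-≢ (j≢i ∘ sym)) ⟩
          N d * 0ℚ - 1ℚ          ≡⟨ cong (_- 1ℚ) (*-zeroʳ (N d)) ⟩
          0ℚ - 1ℚ                ≡⟨ +-identityˡ (- 1ℚ) ⟩
          - 1ℚ                   ∎
          where open ≡-Reasoning

        s₀ : Fin (proj₁ dual-lattice)
        s₀ = proj₁ (∑-pos⇒∃pos ν (subst (0ℚ <_) (sym ∑ν≡1) (toWitness {a? = 0ℚ <? 1ℚ} _)))

        0<νs₀ : 0ℚ < ν s₀
        0<νs₀ = proj₂ (∑-pos⇒∃pos ν (subst (0ℚ <_) (sym ∑ν≡1) (toWitness {a? = 0ℚ <? 1ℚ} _)))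

      scaled-coordinate-integral : ∀ μ → ColumnsInt adj μ → ∀ i → IsInt (N d * μ i - ∑ μ)
      scaled-coordinate-integral μ int i =
        subst IsInt pairing (IsInt-∑ _ (λ k → IsInt-* (int k) (p k , refl)))
        where
        p : Fin d → ℤ
        p = proj₁ (integral-facetNormal i)
        normal : IsFacetNormal i (ι ∘ p)
        normal = proj₂ (integral-facetNormal i)
        pairing : (μ · vert adj) ∙ (ι ∘ p) ≡ N d * μ i - ∑ μ
        pairing = begin
          (μ · vert adj) ∙ (ι ∘ p)                               ≡⟨ ·-∙ μ (vert adj) (ι ∘ p) ⟩
          ∑ (λ r → μ r * (vert adj r ∙ (ι ∘ p)))
            ≡⟨ ∑-cong (λ r → identity (μ r) (vert adj r ∙ (ι ∘ p))) ⟩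
          ∑ (λ r → μ r * (vert adj r ∙ (ι ∘ p) + 1ℚ) - μ r)
            ≡⟨ ∑-distrib-- (λ r → μ r * (vert adj r ∙ (ι ∘ p) + 1ℚ)) μ ⟩
          ∑ (λ r → μ r * (vert adj r ∙ (ι ∘ p) + 1ℚ)) - ∑ μ
            ≡⟨ cong (_- ∑ μ) (∑-supported _ i (λ r r≢i →
                 trans (cong (μ r *_) (trans (cong (_+ 1ℚ) (normal r r≢i)) (+-inverseˡ 1ℚ))) (*-zeroʳ (μ r)))) ⟩
          μ i * (vert adj i ∙ (ι ∘ p) + 1ℚ) - ∑ μ
            ≡⟨ cong (λ t → μ i * t - ∑ μ) (facetNormal-opposite normal) ⟩
          μ i * N d - ∑ μ                                           ≡⟨ cong (_- ∑ μ) (*-comm (μ i) (N d)) ⟩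
          N d * μ i - ∑ μ                                           ∎
          where
          open ≡-Reasoning
          identity : ∀ m c → m * c ≡ m * (c + 1ℚ) - m
          identity = solve-∀ ℚ-ring

      Λ⇒shift-in-cube : ∀ λ₀ → Λ adj λ₀ → InUnitCube (λ r → λ₀ r + H d)
      Λ⇒shift-in-cube λ₀ Λλ₀ r =
        +-mono-≤ (proj₁ (cube r)) (<⇒≤ (0<H d)) ,
        *-cancelˡ-<-nonNeg (N d) {{nonNegative (<⇒≤ (0<ι+ d))}} Nλ+NH<N
        where
        cube = proj₁ (Equivalence.to (Λ⇔ λ₀) Λλ₀)
        ∑-int = proj₁ (proj₂ (Equivalence.to (Λ⇔ λ₀) Λλ₀))
        columns = proj₂ (proj₂ (Equivalence.to (Λ⇔ λ₀) Λλ₀))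
        Nλ-int : IsInt (N d * λ₀ r)
        Nλ-int = subst IsInt (cancel (N d * λ₀ r) (∑ λ₀)) (IsInt-+ (scaled-coordinate-integral λ₀ columns r) ∑-int)
          where
          cancel : ∀ a s → a - s + s ≡ a
          cancel = solve-∀ ℚ-ring
        Nλ<N : N d * λ₀ r < N d
        Nλ<N = subst (N d * λ₀ r <_) (*-identityʳ (N d)) (*-monoʳ-<-pos (N d) {{positive (0<ι+ d)}} (proj₂ (cube r)))
        Nλ+NH<N : N d * (λ₀ r + H d) < N d * 1ℚ
        Nλ+NH<N = subst₂ _<_
          (trans (cong (N d * λ₀ r +_) (sym (N*H≡½ d))) (sym (*-distribˡ-+ (N d) (λ₀ r) (H d))))
          (sym (*-identityʳ (N d)))
          (IsInt-<⇒+½< Nλ-int (ℤ.+ suc d , refl) Nλ<N)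

      halfIntegral⇒unshift-in-cube : ∀ μ → InUnitCube μ → ColumnsInt adj μ → IsInt (∑ μ - ½) →
                                     InUnitCube (λ r → μ r - H d)
      halfIntegral⇒unshift-in-cube μ cube columns ∑-½-int r =
        subst (_≤ μ r - H d) (+-inverseʳ (H d)) (+-monoˡ-≤ (- H d) H≤μ) ,
        ≤-<-trans (subst (μ r - H d ≤_) (+-identityʳ (μ r)) (+-monoʳ-≤ (μ r) (neg-antimono-≤ (<⇒≤ (0<H d)))))
                  (proj₂ (cube r))
        where
        Nμ-½-int : IsInt (N d * μ r - ½)
        Nμ-½-int = subst IsInt (telescope (N d * μ r) (∑ μ) ½) (IsInt-+ (scaled-coordinate-integral μ columns r) ∑-½-int)
          where
          telescope : ∀ a s h → (a - s) + (s - h) ≡ a - h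
          telescope = solve-∀ ℚ-ring
        H≤μ : H d ≤ μ r
        H≤μ = *-cancelˡ-≤-pos (N d) {{positive (0<ι+ d)}}
          (subst (_≤ N d * μ r) (sym (N*H≡½ d)) (IsInt-[-½]⇒½≤ Nμ-½-int (*-pres-0≤ (<⇒≤ (0<ι+ d)) (proj₁ (cube r)))))

      unshift-Λ : ∀ μ → InUnitCube μ → ColumnsInt adj μ → IsInt (∑ μ - ½) → Λ adj (λ r → μ r - H d)
      unshift-Λ μ cube columns ∑-½-int = Equivalence.from (Λ⇔ (λ r → μ r - H d))
        ( halfIntegral⇒unshift-in-cube μ cube columns ∑-½-int
        , subst IsInt (sym (trans (∑-shift μ (- H d))
                                  (cong (∑ μ +_) (trans (sym (neg-distribʳ-* (N d) (H d))) (cong -_ (N*H≡½ d))))))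
                      ∑-½-int
        , shift-columns μ (- H d) columns )

      shift-Λ : ∀ λ₀ → Λ adj λ₀ →
        InUnitCube (λ r → λ₀ r + H d) × ColumnsInt adj (λ r → λ₀ r + H d) × IsInt (∑ (λ r → λ₀ r + H d) - ½)
      shift-Λ λ₀ Λλ₀ =
        Λ⇒shift-in-cube λ₀ Λλ₀ ,
        shift-columns λ₀ (H d) (proj₂ (proj₂ (Equivalence.to (Λ⇔ λ₀) Λλ₀))) ,
        subst IsInt ∑≡ (proj₁ (proj₂ (Equivalence.to (Λ⇔ λ₀) Λλ₀)))
        where
        cancel : ∀ s h → s ≡ s + h - h
        cancel = solve-∀ ℚ-ring
        ∑≡ : ∑ λ₀ ≡ ∑ (λ r → λ₀ r + H d) - ½
        ∑≡ = trans (cancel (∑ λ₀) ½) (cong (_- ½) (sym (trans (∑-shift λ₀ (H d)) (cong (∑ λ₀ +_) (N*H≡½ d)))))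

  module Bridge {k} (G₁ G₂ : Fin (suc k) → Fin (suc k) → Bool) where

    n : ℕ
    n = suc k

    ↑-elim : (P : Fin (n ℕ.+ n) → Set) → (∀ i → P (i ↑ˡ n)) → (∀ i → P (n ↑ʳ i)) → ∀ a → P a
    ↑-elim P on₁ on₂ a = subst P (Fin.join-splitAt n n a) ([_,_] {C = P ∘ join n n} on₁ on₂ (splitAt n a))

    bridge-↑ˡ↑ˡ : ∀ i j → bridge G₁ G₂ (i ↑ˡ n) (j ↑ˡ n) ≡ G₁ i j
    bridge-↑ˡ↑ˡ i j rewrite Fin.splitAt-↑ˡ n i n | Fin.splitAt-↑ˡ n j n = refl

    bridge-↑ʳ↑ʳ : ∀ i j → bridge G₁ G₂ (n ↑ʳ i) (n ↑ʳ j) ≡ G₂ i j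
    bridge-↑ʳ↑ʳ i j rewrite Fin.splitAt-↑ʳ n n i | Fin.splitAt-↑ʳ n n j = refl

    bridge-↑ˡ↑ʳ : ∀ i j → bridge G₁ G₂ (i ↑ˡ n) (n ↑ʳ j) ≡ (if isLast i then isLast j else false)
    bridge-↑ˡ↑ʳ i j rewrite Fin.splitAt-↑ˡ n i n | Fin.splitAt-↑ʳ n n j = refl

    bridge-↑ʳ↑ˡ : ∀ i j → bridge G₁ G₂ (n ↑ʳ i) (j ↑ˡ n) ≡ (if isLast i then isLast j else false)
    bridge-↑ʳ↑ˡ i j rewrite Fin.splitAt-↑ʳ n n i | Fin.splitAt-↑ˡ n j n = refl

    bridge-simple : IsSimple G₁ → IsSimple G₂ → IsSimple (bridge G₁ G₂)
    bridge-simple (sym₁ , loopless₁) (sym₂ , loopless₂) = symmetric , loopless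
      where
      if-sym : ∀ x y → (if x then y else false) ≡ (if y then x else false)
      if-sym true  true  = refl
      if-sym true  false = refl
      if-sym false true  = refl
      if-sym false false = refl
      symmetric : ∀ a b → bridge G₁ G₂ a b ≡ bridge G₁ G₂ b a
      symmetric a b with splitAt n a | splitAt n b
      ... | inj₁ i | inj₁ j = sym₁ i j
      ... | inj₁ i | inj₂ j = if-sym (isLast i) (isLast j)
      ... | inj₂ i | inj₁ j = if-sym (isLast i) (isLast j)
      ... | inj₂ i | inj₂ j = sym₂ i j
      loopless : ∀ a → bridge G₁ G₂ a a ≡ false
      loopless a with splitAt n a
      ... | inj₁ i = loopless₁ i
      ... | inj₂ i = loopless₂ i

    isLast-↑ˡ : ∀ (j : Fin n) → isLast (j ↑ˡ n) ≡ false
    isLast-↑ˡ j = ≡ᵇ-false (ℕ.<⇒≢ (begin-strict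
      toℕ (j ↑ˡ n)  ≡⟨ Fin.toℕ-↑ˡ j n ⟩
      toℕ j         <⟨ Fin.toℕ<n j ⟩
      n             ≤⟨ ℕ.m≤n+m n k ⟩
      k ℕ.+ n       ∎))
      where open ℕ.≤-Reasoning

    isLast-↑ʳ : ∀ (j : Fin n) → isLast (n ↑ʳ j) ≡ isLast j
    isLast-↑ʳ j = begin
      (toℕ (n ↑ʳ j) ℕ.≡ᵇ k ℕ.+ n)  ≡⟨ cong₂ ℕ._≡ᵇ_ (Fin.toℕ-↑ʳ n j) (ℕ.+-comm k n) ⟩
      (n ℕ.+ toℕ j ℕ.≡ᵇ n ℕ.+ k)   ≡⟨ ≡ᵇ-cancelˡ n ⟩
      (toℕ j ℕ.≡ᵇ k)               ∎
      where
      open ≡-Reasoning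
      ≡ᵇ-cancelˡ : ∀ a {x y} → (a ℕ.+ x ℕ.≡ᵇ a ℕ.+ y) ≡ (x ℕ.≡ᵇ y)
      ≡ᵇ-cancelˡ zero    = refl
      ≡ᵇ-cancelˡ (suc a) = ≡ᵇ-cancelˡ a

    left right : (Fin (n ℕ.+ n) → ℚ) → Fin n → ℚ
    left  lam i = lam (i ↑ˡ n)
    right lam i = lam (n ↑ʳ i)

    ++-split : ∀ (lam : Fin (n ℕ.+ n) → ℚ) a → (left lam ++ right lam) a ≡ lam a
    ++-split lam = ↑-elim (λ a → (left lam ++ right lam) a ≡ lam a)
      (Vec.lookup-++ˡ (left lam) (right lam)) (Vec.lookup-++ʳ (left lam) (right lam))

    ++-shift : ∀ (μ₁ μ₂ : Fin n → ℚ) c a → ((λ i → μ₁ i + c) ++ (λ i → μ₂ i + c)) a ≡ (μ₁ ++ μ₂) a + c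
    ++-shift μ₁ μ₂ c a with splitAt n a
    ... | inj₁ i = refl
    ... | inj₂ i = refl

    -- The contribution of the bridge edge to column j of the bridge Laplacian.
    bridgeTerm : ∀ (j : Fin n) → ℚ → (Fin n → ℚ) → ℚ
    bridgeTerm j x y = ∑ (λ i → fromBool (if isLast j then isLast i else false) * (x - y i))

    bridgeTerm-inject₁ : ∀ j x y → bridgeTerm (inject₁ j) x y ≡ 0ℚ
    bridgeTerm-inject₁ j x y rewrite isLast-inject₁ j = ∑-0* (λ i → x - y i)

    bridgeTerm-last : ∀ x y → bridgeTerm (fromℕ k) x y ≡ x - y (fromℕ k)
    bridgeTerm-last x y rewrite isLast-fromℕ k = ∑-isLast (λ i → x - y i)

    BridgeConditions : (Fin n → ℚ) → (Fin n → ℚ) → Set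
    BridgeConditions μ₁ μ₂ =
      ColumnsInt G₁ μ₁ × ColumnsInt G₂ μ₂ × IsInt (μ₁ (fromℕ k) - μ₂ (fromℕ k)) × IsInt (∑ μ₁ + ∑ μ₂)

    BridgeConditions-resp : ∀ {μ₁ μ₂ ν₁ ν₂} → (∀ i → μ₁ i ≡ ν₁ i) → (∀ i → μ₂ i ≡ ν₂ i) →
                           BridgeConditions μ₁ μ₂ → BridgeConditions ν₁ ν₂
    BridgeConditions-resp {μ₁} {μ₂} {ν₁} {ν₂} μ₁≗ν₁ μ₂≗ν₂ (columns₁ , columns₂ , diff , sum) =
      (λ j → subst IsInt (∑-cong (λ r → cong (_* vert G₁ r j) (μ₁≗ν₁ r))) (columns₁ j)) ,
      (λ j → subst IsInt (∑-cong (λ r → cong (_* vert G₂ r j) (μ₂≗ν₂ r))) (columns₂ j)) ,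
      subst IsInt (cong₂ _-_ (μ₁≗ν₁ (fromℕ k)) (μ₂≗ν₂ (fromℕ k))) diff ,
      subst IsInt (cong₂ _+_ (∑-cong μ₁≗ν₁) (∑-cong μ₂≗ν₂)) sum

    module Columns (simple₁ : IsSimple G₁) (simple₂ : IsSimple G₂) (lam : Fin (n ℕ.+ n) → ℚ) where

      module GL₁ = GraphLaplacian G₁ simple₁
      module GL₂ = GraphLaplacian G₂ simple₂
      module GLB = GraphLaplacian (bridge G₁ G₂) (bridge-simple simple₁ simple₂)
      module LS₁ = LaplacianSimplex G₁ simple₁

      column-↑ˡ : ∀ j → (lam · Lap (bridge G₁ G₂)) (j ↑ˡ n) ≡
                        (left lam · Lap G₁) j + bridgeTerm j (left lam j) (right lam)
      column-↑ˡ j = begin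
        (lam · Lap (bridge G₁ G₂)) (j ↑ˡ n)
          ≡⟨ GLB.column-action lam (j ↑ˡ n) ⟩
        weightedLaplacian GLB.weights lam (j ↑ˡ n)
          ≡⟨ ∑-↑ n (λ a → GLB.weights (j ↑ˡ n) a * (left lam j - lam a)) ⟩
        ∑ (λ i → fromBool (bridge G₁ G₂ (j ↑ˡ n) (i ↑ˡ n)) * (left lam j - left lam i)) +
        ∑ (λ i → fromBool (bridge G₁ G₂ (j ↑ˡ n) (n ↑ʳ i)) * (left lam j - right lam i))
          ≡⟨ cong₂ _+_ (∑-cong (λ i → cong (λ b → fromBool b * (left lam j - left lam i)) (bridge-↑ˡ↑ˡ j i)))
                       (∑-cong (λ i → cong (λ b → fromBool b * (left lam j - right lam i)) (bridge-↑ˡ↑ʳ j i))) ⟩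
        weightedLaplacian GL₁.weights (left lam) j + bridgeTerm j (left lam j) (right lam)
          ≡⟨ cong (_+ bridgeTerm j (left lam j) (right lam)) (GL₁.column-action (left lam) j) ⟨
        (left lam · Lap G₁) j + bridgeTerm j (left lam j) (right lam)
          ∎
        where open ≡-Reasoning

      column-↑ʳ : ∀ j → (lam · Lap (bridge G₁ G₂)) (n ↑ʳ j) ≡
                        bridgeTerm j (right lam j) (left lam) + (right lam · Lap G₂) j
      column-↑ʳ j = begin
        (lam · Lap (bridge G₁ G₂)) (n ↑ʳ j)
          ≡⟨ GLB.column-action lam (n ↑ʳ j) ⟩
        weightedLaplacian GLB.weights lam (n ↑ʳ j)
          ≡⟨ ∑-↑ n (λ a → GLB.weights (n ↑ʳ j) a * (right lam j - lam a)) ⟩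
        ∑ (λ i → fromBool (bridge G₁ G₂ (n ↑ʳ j) (i ↑ˡ n)) * (right lam j - left lam i)) +
        ∑ (λ i → fromBool (bridge G₁ G₂ (n ↑ʳ j) (n ↑ʳ i)) * (right lam j - right lam i))
          ≡⟨ cong₂ _+_ (∑-cong (λ i → cong (λ b → fromBool b * (right lam j - left lam i)) (bridge-↑ʳ↑ˡ j i)))
                       (∑-cong (λ i → cong (λ b → fromBool b * (right lam j - right lam i)) (bridge-↑ʳ↑ʳ j i))) ⟩
        bridgeTerm j (right lam j) (left lam) + weightedLaplacian GL₂.weights (right lam) j
          ≡⟨ cong (bridgeTerm j (right lam j) (left lam) +_) (GL₂.column-action (right lam) j) ⟨
        bridgeTerm j (right lam j) (left lam) + (right lam · Lap G₂) j
          ∎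
        where open ≡-Reasoning

      column₁ : ∀ j → (lam · augL (bridge G₁ G₂)) (inject₁ j ↑ˡ n) ≡ (left lam · vert G₁) j
      column₁ j = begin
        (lam · augL (bridge G₁ G₂)) (inject₁ j ↑ˡ n)
          ≡⟨ augL-nonLast (bridge G₁ G₂) lam {inject₁ j ↑ˡ n} (isLast-↑ˡ (inject₁ j)) ⟩
        (lam · Lap (bridge G₁ G₂)) (inject₁ j ↑ˡ n)                          ≡⟨ column-↑ˡ (inject₁ j) ⟩
        (left lam · vert G₁) j + bridgeTerm (inject₁ j) (left lam (inject₁ j)) (right lam)
          ≡⟨ cong ((left lam · vert G₁) j +_) (bridgeTerm-inject₁ j (left lam (inject₁ j)) (right lam)) ⟩
        (left lam · vert G₁) j + 0ℚ                                   ≡⟨ +-identityʳ _ ⟩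
        (left lam · vert G₁) j                                        ∎
        where open ≡-Reasoning

      column₁-last : (lam · augL (bridge G₁ G₂)) (fromℕ k ↑ˡ n) ≡
                     (left lam · Lap G₁) (fromℕ k) + (left lam (fromℕ k) - right lam (fromℕ k))
      column₁-last = begin
        (lam · augL (bridge G₁ G₂)) (fromℕ k ↑ˡ n)
          ≡⟨ augL-nonLast (bridge G₁ G₂) lam {fromℕ k ↑ˡ n} (isLast-↑ˡ (fromℕ k)) ⟩
        (lam · Lap (bridge G₁ G₂)) (fromℕ k ↑ˡ n)                     ≡⟨ column-↑ˡ (fromℕ k) ⟩
        (left lam · Lap G₁) (fromℕ k) + bridgeTerm (fromℕ k) (left lam (fromℕ k)) (right lam)
          ≡⟨ cong ((left lam · Lap G₁) (fromℕ k) +_) (bridgeTerm-last (left lam (fromℕ k)) (right lam)) ⟩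
        (left lam · Lap G₁) (fromℕ k) + (left lam (fromℕ k) - right lam (fromℕ k))            ∎
        where open ≡-Reasoning

      column₂ : ∀ j → (lam · augL (bridge G₁ G₂)) (n ↑ʳ inject₁ j) ≡ (right lam · vert G₂) j
      column₂ j = begin
        (lam · augL (bridge G₁ G₂)) (n ↑ʳ inject₁ j)
          ≡⟨ augL-nonLast (bridge G₁ G₂) lam {n ↑ʳ inject₁ j} (trans (isLast-↑ʳ (inject₁ j)) (isLast-inject₁ j)) ⟩
        (lam · Lap (bridge G₁ G₂)) (n ↑ʳ inject₁ j)                          ≡⟨ column-↑ʳ (inject₁ j) ⟩
        bridgeTerm (inject₁ j) (right lam (inject₁ j)) (left lam) + (right lam · vert G₂) j
          ≡⟨ cong (_+ (right lam · vert G₂) j) (bridgeTerm-inject₁ j (right lam (inject₁ j)) (left lam)) ⟩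
        0ℚ + (right lam · vert G₂) j                                   ≡⟨ +-identityˡ _ ⟩
        (right lam · vert G₂) j                                        ∎
        where open ≡-Reasoning

      column₂-last : (lam · augL (bridge G₁ G₂)) (n ↑ʳ fromℕ k) ≡ ∑ (left lam) + ∑ (right lam)
      column₂-last =
        trans (augL-isLast (bridge G₁ G₂) lam {n ↑ʳ fromℕ k} (trans (isLast-↑ʳ (fromℕ k)) (isLast-fromℕ k))) (∑-↑ n lam)

      Integral : Set
      Integral = ∀ a → IsInt ((lam · augL (bridge G₁ G₂)) a)

      integral⇒columns₁ : Integral → ColumnsInt G₁ (left lam)
      integral⇒columns₁ int j = subst IsInt (column₁ j) (int (inject₁ j ↑ˡ n))

      integral⇒difference : Integral → IsInt (left lam (fromℕ k) - right lam (fromℕ k))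
      integral⇒difference int =
        subst IsInt (xyx⁻¹≈y ((left lam · Lap G₁) (fromℕ k)) (left lam (fromℕ k) - right lam (fromℕ k)))
        (IsInt-- (subst IsInt column₁-last (int (fromℕ k ↑ˡ n))) (LS₁.lastColumn-int (left lam) (integral⇒columns₁ int)))

      integral⇒conditions : Integral → BridgeConditions (left lam) (right lam)
      integral⇒conditions int =
        integral⇒columns₁ int ,
        (λ j → subst IsInt (column₂ j) (int (n ↑ʳ inject₁ j))) ,
        integral⇒difference int ,
        subst IsInt column₂-last (int (n ↑ʳ fromℕ k))

      conditions⇒integral : BridgeConditions (left lam) (right lam) → Integral
      conditions⇒integral (columns₁ , columns₂ , diff , sum) =
        ↑-elim (λ a → IsInt ((lam · augL (bridge G₁ G₂)) a)) (λ j → block₁ j (Top.view j)) (λ j → block₂ j (Top.view j))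
        where
        block₁ : ∀ j → Top.View j → IsInt ((lam · augL (bridge G₁ G₂)) (j ↑ˡ n))
        block₁ _ Top.‵fromℕ       = subst IsInt (sym column₁-last) (IsInt-+ (LS₁.lastColumn-int (left lam) columns₁) diff)
        block₁ _ (Top.‵inject₁ j) = subst IsInt (sym (column₁ j)) (columns₁ j)
        block₂ : ∀ j → Top.View j → IsInt ((lam · augL (bridge G₁ G₂)) (n ↑ʳ j))
        block₂ _ Top.‵fromℕ       = subst IsInt (sym column₂-last) sum
        block₂ _ (Top.‵inject₁ j) = subst IsInt (sym (column₂ j)) (columns₂ j)

  module BridgeLatticePoints {k} (G₁ G₂ : Fin (suc k) → Fin (suc k) → Bool)
    (simple₁ : IsSimple G₁) (connected₁ : IsConnected G₁) (simple₂ : IsSimple G₂) (connected₂ : IsConnected G₂)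
    (reflexive₁ : IsReflexive (LaplacianSimplex G₁)) (reflexive₂ : IsReflexive (LaplacianSimplex G₂)) where

    open Bridge G₁ G₂
    module LS₁ = LaplacianSimplex G₁ simple₁
    module LS₂ = LaplacianSimplex G₂ simple₂

    ΛPair : (Fin n → ℚ) → (Fin n → ℚ) → Set
    ΛPair λ₁ λ₂ = Λ G₁ λ₁ × Λ G₂ λ₂ × λ₁ (fromℕ k) ≡ λ₂ (fromℕ k)

    ΛPair⇒conditions : ∀ {λ₁ λ₂} → ΛPair λ₁ λ₂ → BridgeConditions λ₁ λ₂
    ΛPair⇒conditions {λ₁} {λ₂} (Λ₁ , Λ₂ , λ₁≡λ₂) =
      proj₂ (proj₂ Λ₁′) , proj₂ (proj₂ Λ₂′) ,
      (ℤ.+ 0 , trans (cong (_- λ₂ (fromℕ k)) λ₁≡λ₂) (+-inverseʳ (λ₂ (fromℕ k)))) ,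
      IsInt-+ (proj₁ (proj₂ Λ₁′)) (proj₁ (proj₂ Λ₂′))
      where
      Λ₁′ = Equivalence.to (LS₁.Λ⇔ λ₁) Λ₁
      Λ₂′ = Equivalence.to (LS₂.Λ⇔ λ₂) Λ₂

    ΛPair⇒shifted-conditions : ∀ {λ₁ λ₂} → ΛPair λ₁ λ₂ →
      InUnitCube (λ r → λ₁ r + H k) × InUnitCube (λ r → λ₂ r + H k) ×
      BridgeConditions (λ r → λ₁ r + H k) (λ r → λ₂ r + H k)
    ΛPair⇒shifted-conditions {λ₁} {λ₂} (Λ₁ , Λ₂ , λ₁≡λ₂) =
      let cube₁ , columns₁ , half₁ = LS₁.shift-Λ connected₁ reflexive₁ λ₁ Λ₁
          cube₂ , columns₂ , half₂ = LS₂.shift-Λ connected₂ reflexive₂ λ₂ Λ₂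
      in cube₁ , cube₂ , columns₁ , columns₂ ,
         (ℤ.+ 0 , trans (cong (λ t → (t + H k) - (λ₂ (fromℕ k) + H k)) λ₁≡λ₂) (+-inverseʳ (λ₂ (fromℕ k) + H k))) ,
         subst IsInt (two-halves (∑ (λ r → λ₁ r + H k)) (∑ (λ r → λ₂ r + H k)))
                     (IsInt-+ (IsInt-+ half₁ half₂) (ℤ.+ 1 , refl))
      where
      two-halves : ∀ a b → (a - ½) + (b - ½) + 1ℚ ≡ a + b
      two-halves = solve-∀ ℚ-ring

    conditions⇒glued : ∀ {μ₁ μ₂} → InUnitCube μ₁ → InUnitCube μ₂ → BridgeConditions μ₁ μ₂ →
                       μ₁ (fromℕ k) ≡ μ₂ (fromℕ k)
    conditions⇒glued cube₁ cube₂ (_ , _ , diff , _) =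
      IsInt-diff⇒≡ (proj₁ (cube₁ (fromℕ k))) (proj₂ (cube₁ (fromℕ k)))
                   (proj₁ (cube₂ (fromℕ k))) (proj₂ (cube₂ (fromℕ k))) diff

    conditions⇒double-sum : ∀ {μ₁ μ₂} → μ₁ (fromℕ k) ≡ μ₂ (fromℕ k) → BridgeConditions μ₁ μ₂ →
                            IsInt (∑ μ₁ + ∑ μ₁)
    conditions⇒double-sum {μ₁} {μ₂} μ₁≡μ₂ (columns₁ , columns₂ , _ , sum) =
      subst IsInt (telescope (N k * μ₁ (fromℕ k)) (∑ μ₁) (∑ μ₂))
        (IsInt-- sum (IsInt-- (LS₁.scaled-coordinate-integral connected₁ reflexive₁ μ₁ columns₁ (fromℕ k))
                              (subst (λ t → IsInt (N k * t - ∑ μ₂)) (sym μ₁≡μ₂)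
                                     (LS₂.scaled-coordinate-integral connected₂ reflexive₂ μ₂ columns₂ (fromℕ k)))))
      where
      telescope : ∀ a s₁ s₂ → (s₁ + s₂) - ((a - s₁) - (a - s₂)) ≡ s₁ + s₁
      telescope = solve-∀ ℚ-ring

    conditions⇒ΛPair : ∀ {μ₁ μ₂} → InUnitCube μ₁ → InUnitCube μ₂ → BridgeConditions μ₁ μ₂ →
                       ΛPair μ₁ μ₂ ⊎ ΛPair (λ r → μ₁ r - H k) (λ r → μ₂ r - H k)
    conditions⇒ΛPair {μ₁} {μ₂} cube₁ cube₂ conditions@(columns₁ , columns₂ , _ , sum)
      with IsInt-double (conditions⇒double-sum {μ₁} {μ₂} (conditions⇒glued {μ₁} {μ₂} cube₁ cube₂ conditions) conditions)
    ... | inj₁ ∑₁-int = inj₁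
          ( Equivalence.from (LS₁.Λ⇔ μ₁) (cube₁ , ∑₁-int , columns₁)
          , Equivalence.from (LS₂.Λ⇔ μ₂)
              (cube₂ , subst IsInt (cancel (∑ μ₁) (∑ μ₂)) (IsInt-- sum ∑₁-int) , columns₂)
          , conditions⇒glued {μ₁} {μ₂} cube₁ cube₂ conditions )
      where
      cancel : ∀ a b → (a + b) - a ≡ b
      cancel = solve-∀ ℚ-ring
    ... | inj₂ ∑₁-½-int = inj₂
          ( LS₁.unshift-Λ connected₁ reflexive₁ μ₁ cube₁ columns₁ ∑₁-½-int
          , LS₂.unshift-Λ connected₂ reflexive₂ μ₂ cube₂ columns₂
              (subst IsInt (cancel (∑ μ₁) (∑ μ₂)) (IsInt-- (IsInt-- sum ∑₁-½-int) (ℤ.+ 1 , refl)))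
          , cong (_- H k) (conditions⇒glued {μ₁} {μ₂} cube₁ cube₂ conditions) )
      where
      cancel : ∀ a b → (a + b) - (a - ½) - 1ℚ ≡ b - ½
      cancel = solve-∀ ℚ-ring

    lattice-point : ∀ z lam {μ₁ μ₂} → (∀ i → left lam i ≡ μ₁ i) → (∀ i → right lam i ≡ μ₂ i) →
                    InUnitCube μ₁ → InUnitCube μ₂ → BridgeConditions μ₁ μ₂ →
                    (∀ j → z j ≡ (lam · augL (bridge G₁ G₂)) j) → FPPLatticePoint (bridge G₁ G₂) z
    lattice-point z lam {μ₁} {μ₂} lam≗μ₁ lam≗μ₂ cube₁ cube₂ conditions z≡ =
      (λ a → subst IsInt (sym (z≡ a)) (Columns.conditions⇒integral simple₁ simple₂ lam conditions′ a)) ,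
      lam ,
      ↑-elim (λ a → (0ℚ ≤ lam a) × (lam a < 1ℚ))
        (λ i → subst (λ t → (0ℚ ≤ t) × (t < 1ℚ)) (sym (lam≗μ₁ i)) (cube₁ i))
        (λ i → subst (λ t → (0ℚ ≤ t) × (t < 1ℚ)) (sym (lam≗μ₂ i)) (cube₂ i)) ,
      z≡
      where
      conditions′ : BridgeConditions (left lam) (right lam)
      conditions′ = BridgeConditions-resp {μ₁} {μ₂} {left lam} {right lam} (sym ∘ lam≗μ₁) (sym ∘ lam≗μ₂) conditions

    Decomposition : (Fin (n ℕ.+ n) → ℚ) → Set
    Decomposition z = Σ (Fin n → ℚ) λ λ₁ → Σ (Fin n → ℚ) λ λ₂ →
      Λ G₁ λ₁ × Λ G₂ λ₂ × λ₁ (fromℕ k) ≡ λ₂ (fromℕ k) ×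
      ((∀ j → z j ≡ ((λ₁ ++ λ₂) · augL (bridge G₁ G₂)) j) ⊎
       (∀ j → z j ≡ ((λ i → (λ₁ ++ λ₂) i + H k) · augL (bridge G₁ G₂)) j))

    unshift : ∀ lam a → lam a ≡ ((λ r → left lam r - H k) ++ (λ r → right lam r - H k)) a + H k
    unshift lam a = begin
      lam a                              ≡⟨ ++-split lam a ⟨
      (left lam ++ right lam) a          ≡⟨ cancel ((left lam ++ right lam) a) (H k) ⟩
      (left lam ++ right lam) a - H k + H k
        ≡⟨ cong (_+ H k) (++-shift (left lam) (right lam) (- H k) a) ⟨
      ((λ r → left lam r - H k) ++ (λ r → right lam r - H k)) a + H k  ∎
      where
      open ≡-Reasoning
      cancel : ∀ a h → a ≡ a - h + h
      cancel = solve-∀ ℚ-ring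

    pair⇒decomposition : ∀ z lam → (∀ j → z j ≡ (lam · augL (bridge G₁ G₂)) j) →
      ΛPair (left lam) (right lam) ⊎ ΛPair (λ r → left lam r - H k) (λ r → right lam r - H k) → Decomposition z
    pair⇒decomposition z lam z≡ (inj₁ (Λ₁ , Λ₂ , glued)) =
      left lam , right lam , Λ₁ , Λ₂ , glued ,
      inj₁ (λ j → trans (z≡ j) (·-congˡ (augL (bridge G₁ G₂)) (sym ∘ ++-split lam) j))
    pair⇒decomposition z lam z≡ (inj₂ (Λ₁ , Λ₂ , glued)) =
      (λ r → left lam r - H k) , (λ r → right lam r - H k) , Λ₁ , Λ₂ , glued ,
      inj₂ (λ j → trans (z≡ j) (·-congˡ (augL (bridge G₁ G₂)) (unshift lam) j))

    fpp⇒decomposition : ∀ z → FPPLatticePoint (bridge G₁ G₂) z → Decomposition z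
    fpp⇒decomposition z (z-int , lam , cube , z≡) = pair⇒decomposition z lam z≡
      (conditions⇒ΛPair {left lam} {right lam} (λ i → cube (i ↑ˡ n)) (λ i → cube (n ↑ʳ i))
        (Columns.integral⇒conditions simple₁ simple₂ lam (λ a → subst IsInt (z≡ a) (z-int a))))

    decomposition⇒fpp : ∀ z → Decomposition z → FPPLatticePoint (bridge G₁ G₂) z
    decomposition⇒fpp z (λ₁ , λ₂ , Λ₁ , Λ₂ , glued , inj₁ z≡) =
      lattice-point z (λ₁ ++ λ₂) {λ₁} {λ₂} (Vec.lookup-++ˡ λ₁ λ₂) (Vec.lookup-++ʳ λ₁ λ₂) (proj₁ Λ₁) (proj₁ Λ₂)
        (ΛPair⇒conditions {λ₁} {λ₂} (Λ₁ , Λ₂ , glued)) z≡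
    decomposition⇒fpp z (λ₁ , λ₂ , Λ₁ , Λ₂ , glued , inj₂ z≡) =
      let cube₁ , cube₂ , conditions = ΛPair⇒shifted-conditions {λ₁} {λ₂} (Λ₁ , Λ₂ , glued)
      in lattice-point z (λ i → (λ₁ ++ λ₂) i + H k) {λ r → λ₁ r + H k} {λ r → λ₂ r + H k}
           (cong (_+ H k) ∘ Vec.lookup-++ˡ λ₁ λ₂) (cong (_+ H k) ∘ Vec.lookup-++ʳ λ₁ λ₂)
           cube₁ cube₂ conditions z≡

open import Data.Bool using (Bool)
open import Data.Nat using (ℕ; suc; _+_)
open import Data.Fin using (Fin; fromℕ)
open import Data.Product using (Σ; _×_)
open import Data.Sum using (_⊎_)
open import Data.Integer using (+_)
open import Data.Rational using (ℚ; _/_)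
open import Data.Vec.Functional using (_++_)
open import Relation.Binary.PropositionalEquality using (_≡_)
open import Function.Bundles using (_⇔_; mk⇔)

theorem3p30 : (k : ℕ) (G₁ G₂ : Fin (suc k) → Fin (suc k) → Bool) →
  IsSimple G₁ → IsConnected G₁ → IsSimple G₂ → IsConnected G₂ →
  IsReflexive (LaplacianSimplex G₁) → IsReflexive (LaplacianSimplex G₂) →
  (z : Fin (suc k + suc k) → ℚ) →
  FPPLatticePoint (bridge G₁ G₂) z ⇔
    Σ (Fin (suc k) → ℚ) λ λ₁ → Σ (Fin (suc k) → ℚ) λ λ₂ →
      Λ G₁ λ₁ × Λ G₂ λ₂ × (λ₁ (fromℕ k) ≡ λ₂ (fromℕ k)) ×
      ((∀ j → z j ≡ ((λ₁ ++ λ₂) · augL (bridge G₁ G₂)) j) ⊎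
       (∀ j → z j ≡ ((λ i → (λ₁ ++ λ₂) i Data.Rational.+ (+ 1 / (suc k + suc k))) · augL (bridge G₁ G₂)) j))
theorem3p30 k G₁ G₂ simple₁ connected₁ simple₂ connected₂ reflexive₁ reflexive₂ z =
  mk⇔ (fpp⇒decomposition z) (decomposition⇒fpp z)
  where open BridgeLatticePoints G₁ G₂ simple₁ connected₁ simple₂ connected₂ reflexive₁ reflexive₂
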